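{- For all $n\ge2$, $\Omega_n\subset\Omega'_n$.
   Context: $\tilde S_n$ is the group of bijections $w:\mathbb Z\to\mathbb Z$ with $w(i+n)=w(i)+n$ and $\sum_{i=1}^nw(i)=\sum_{i=1}^ni$, a Coxeter group with simple generators $s_0,\dots,s_{n-1}$, $s_i$ mapping $j\mapsto j+1$ if $j\equiv i$, $j\mapsto j-1$ if $j\equiv i+1\pmod n$, fixing $j$ otherwise; $\ell$ is length; $\tau_n(i)=n+1-i$. $\Omega_n=\{w\in\tilde S_n: w^2=1,\ \ell(s_iw)=\ell(ws_i)=\ell(w)+1\ \forall 1\le i\le n-1\}$ and $\Omega'_n=\{w\in\tilde S_n:(\tau_nw)^2=1,\ \ell(s_iw)=\ell(ws_i)=\ell(w)+1\ \forall 1\le i\le n-1\}$. -}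

module Defs where

open import Data.Nat as ℕ using (ℕ; zero; suc; _≡ᵇ_)
import Data.Nat.DivMod as ℕD
open import Data.Integer using (ℤ; +_; _+_; _-_; _%ℕ_)
open import Data.Fin using (Fin; toℕ)
open import Data.List using (List; []; _∷_; length)
open import Data.Bool using (if_then_else_)
open import Data.Product using (Σ; _×_)
open import Function.Definitions using (Injective; Surjective)
open import Relation.Binary.PropositionalEquality using (_≡_)

_≈_ : (ℤ → ℤ) → (ℤ → ℤ) → Set
f ≈ g = ∀ x → f x ≡ g x

infixr 9 _∘_
_∘_ : (ℤ → ℤ) → (ℤ → ℤ) → (ℤ → ℤ)
(f ∘ g) x = f (g x)

idℤ : ℤ → ℤ
idℤ x = x

sum1to : ℕ → (ℤ → ℤ) → ℤ
sum1to zero    f = + 0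
sum1to (suc m) f = sum1to m f + f (+ suc m)

record IsAffinePerm (n : ℕ) (w : ℤ → ℤ) : Set where
  field
    injective  : Injective _≡_ _≡_ w
    surjective : Surjective _≡_ _≡_ w
    periodic   : ∀ i → w (i + + n) ≡ w i + + n
    sumCond    : sum1to n w ≡ sum1to n idℤ

s : (n : ℕ) → Fin n → ℤ → ℤ
s zero    () j
s (suc m) i j =
  if (j %ℕ suc m) ≡ᵇ toℕ i then j + + 1
  else if (j %ℕ suc m) ≡ᵇ (ℕD._%_ (suc (toℕ i)) (suc m)) then j - + 1
  else j

evalWord : (n : ℕ) → List (Fin n) → ℤ → ℤ
evalWord n []       = idℤ
evalWord n (i ∷ is) = s n i ∘ evalWord n is

IsLength : (n : ℕ) → (ℤ → ℤ) → ℕ → Set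
IsLength n w k =
  Σ (List (Fin n)) (λ ws → length ws ≡ k × evalWord n ws ≈ w)
  × (∀ (ws : List (Fin n)) → evalWord n ws ≈ w → k ℕ.≤ length ws)

LengthUp : (n : ℕ) → (w v : ℤ → ℤ) → Set
LengthUp n w v = ∀ k → IsLength n w k → IsLength n v (suc k)

MinimalCondition : (n : ℕ) → (ℤ → ℤ) → Set
MinimalCondition n w =
  ∀ (i : Fin n) → 1 ℕ.≤ toℕ i → LengthUp n w (s n i ∘ w) × LengthUp n w (w ∘ s n i)

τ : ℕ → ℤ → ℤ
τ n i = + (suc n) - i

Ω : (n : ℕ) → (ℤ → ℤ) → Set
Ω n w = IsAffinePerm n w × (w ∘ w) ≈ idℤ × MinimalCondition n w

Ω′ : (n : ℕ) → (ℤ → ℤ) → Set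
Ω′ n w = IsAffinePerm n w × ((τ n ∘ w) ∘ (τ n ∘ w)) ≈ idℤ × MinimalCondition n w

-- Shi's inversion count L(f) = Σ_{0 ≤ i, j < n} #{t | (i, j + t n) is an inversion of f} changes by
-- exactly one under right multiplication by a generator s_k, dropping precisely when f(k) > f(k + 1),
-- and an element without such a descent is the identity; so L is the Coxeter length. The minimality
-- condition ℓ(w s_i) = ℓ(w) + 1 (1 ≤ i < n) therefore means w(1) < w(2) < ⋯ < w(n).
-- Write w(p) = r(p) + q(p) n with 1 ≤ r(p) ≤ n. For an involution, r is an involution of {1, …, n}
-- with q ∘ r = -q, and q is weakly increasing; a pigeonhole count forces q(n + 1 - p) = -q(p). Then
-- p ↦ r(n + 1 - r(p)) is a decreasing self-map of {1, …, n}, hence p ↦ n + 1 - p, which says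
-- w(n + 1 - x) = n + 1 - w(x). So w commutes with τ_n and (τ_n w)² = w² = 1.

module Submission where

open import Algebra.Structures using (IsCommutativeMonoid)
open import Data.Bool.Base using (Bool; true; false; T; if_then_else_)
open import Data.Empty using (⊥; ⊥-elim)
open import Data.Fin.Base as Fin using (Fin; toℕ)
import Data.Fin.Properties as Fin
open import Data.Integer.Base as ℤ using (ℤ; +_; -[1+_]; _+_; _-_; _*_; -_)
import Data.Integer.DivMod as ℤ
import Data.Integer.Properties as ℤ
open import Data.Integer.Tactic.RingSolver using (solve-∀)
open import Data.List.Base using ([]; _∷_; _++_; length)
import Data.List.Properties as List
open import Data.Nat.Base as ℕ using (ℕ; zero; suc; _≡ᵇ_; _<ᵇ_)
import Data.Nat.DivMod as ℕ
import Data.Nat.Properties as ℕ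
open import Data.Product.Base using (∃; _×_; _,_; proj₂)
open import Data.Sum.Base using (_⊎_; inj₁; inj₂; [_,_]′)
open import Function.Definitions using (Injective)
open import Relation.Binary.Definitions using (tri<; tri≈; tri>)
open import Relation.Binary.PropositionalEquality
open import Relation.Nullary using (¬_; yes; no)

open import Defs

open import Algebra.Properties.AbelianGroup ℤ.+-0-abelianGroup using () renaming (∙-cancelʳ to ℤ+-cancelʳ)

<⇒≡+suc : ∀ {a b : ℤ} → a ℤ.< b → ∃ λ k → b ≡ a + + suc k
<⇒≡+suc {a} {b} a<b = ℤ.∣ b - sa ∣ , (begin
  b                     ≡⟨ split b sa ⟩
  sa + (b - sa)         ≡⟨ cong (λ x → sa + x) (ℤ.0≤i⇒+∣i∣≡i (ℤ.i≤j⇒0≤j-i (ℤ.i<j⇒suc[i]≤j a<b))) ⟨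
  sa + + ℤ.∣ b - sa ∣   ≡⟨ shift a (+ ℤ.∣ b - sa ∣) ⟩
  a + + suc ℤ.∣ b - sa ∣ ∎)
  where
  open ≡-Reasoning
  sa : ℤ
  sa = ℤ.suc a
  split : ∀ b c → b ≡ c + (b - c)
  split = solve-∀
  shift : ∀ a x → (+ 1 + a) + x ≡ a + (+ 1 + x)
  shift = solve-∀

≡ᵇ-true⇒≡ : ∀ {a b} → (a ≡ᵇ b) ≡ true → a ≡ b
≡ᵇ-true⇒≡ {a} {b} e = ℕ.≡ᵇ⇒≡ a b (subst T (sym e) _)

≡ᵇ-false⇒≢ : ∀ {a b} → (a ≡ᵇ b) ≡ false → a ≢ b
≡ᵇ-false⇒≢ {a} {b} e a≡b = subst T e (ℕ.≡⇒≡ᵇ a b a≡b)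

≡ᵇ-refl : ∀ a → (a ≡ᵇ a) ≡ true
≡ᵇ-refl zero    = refl
≡ᵇ-refl (suc a) = ≡ᵇ-refl a

≢⇒≡ᵇ-false : ∀ {a b} → a ≢ b → (a ≡ᵇ b) ≡ false
≢⇒≡ᵇ-false {a} {b} a≢b with a ≡ᵇ b in e
... | true  = ⊥-elim (a≢b (≡ᵇ-true⇒≡ e))
... | false = refl

<⇒<ᵇ-true : ∀ {a b} → a ℕ.< b → (a <ᵇ b) ≡ true
<⇒<ᵇ-true {a} {b} a<b with a <ᵇ b | ℕ.<⇒<ᵇ a<b
... | true | _ = refl

≮⇒<ᵇ-false : ∀ {a b} → ¬ (a ℕ.< b) → (a <ᵇ b) ≡ false
≮⇒<ᵇ-false {a} {b} a≮b with a <ᵇ b in e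
... | true  = ⊥-elim (a≮b (ℕ.<ᵇ⇒< a b (subst T (sym e) _)))
... | false = refl

<ᵇ-cong : ∀ {a b c d} → (a ℕ.< b → c ℕ.< d) → (c ℕ.< d → a ℕ.< b) → (a <ᵇ b) ≡ (c <ᵇ d)
<ᵇ-cong {a} {b} a<b⇒c<d c<d⇒a<b with a ℕ.<? b
... | yes a<b = trans (<⇒<ᵇ-true a<b) (sym (<⇒<ᵇ-true (a<b⇒c<d a<b)))
... | no  a≮b = trans (≮⇒<ᵇ-false a≮b) (sym (≮⇒<ᵇ-false (λ c<d → a≮b (c<d⇒a<b c<d))))

swapAdj : ℕ → ℕ → ℕ
swapAdj K i = if i ≡ᵇ K then suc K else if i ≡ᵇ suc K then K else i

swapAdj-at : ∀ K → swapAdj K K ≡ suc K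
swapAdj-at K rewrite ≡ᵇ-refl K = refl

swapAdj-at-suc : ∀ K → swapAdj K (suc K) ≡ K
swapAdj-at-suc K rewrite ≢⇒≡ᵇ-false (ℕ.1+n≢n {K}) | ≡ᵇ-refl K = refl

swapAdj-other : ∀ K i → i ≢ K → i ≢ suc K → swapAdj K i ≡ i
swapAdj-other K i i≢K i≢sK rewrite ≢⇒≡ᵇ-false i≢K | ≢⇒≡ᵇ-false i≢sK = refl

swapAdj-involutive : ∀ K i → swapAdj K (swapAdj K i) ≡ i
swapAdj-involutive K i with i ≡ᵇ K in e₁
... | true = trans (swapAdj-at-suc K) (sym (≡ᵇ-true⇒≡ e₁))
... | false with i ≡ᵇ suc K in e₂
...   | true  = trans (swapAdj-at K) (sym (≡ᵇ-true⇒≡ e₂))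
...   | false = swapAdj-other K i (≡ᵇ-false⇒≢ e₁) (≡ᵇ-false⇒≢ e₂)

swapAdj-< : ∀ K {i t} → suc K ℕ.< t → i ℕ.< t → swapAdj K i ℕ.< t
swapAdj-< K {i} sK<t i<t with i ≡ᵇ K
... | true = sK<t
... | false with i ≡ᵇ suc K
...   | true  = ℕ.<-trans (ℕ.n<1+n K) sK<t
...   | false = i<t

swapAdj-preserves-< : ∀ K i j → ¬ (i ≡ K × j ≡ suc K) → ¬ (i ≡ suc K × j ≡ K) →
                      (i <ᵇ j) ≡ (swapAdj K i <ᵇ swapAdj K j)
swapAdj-preserves-< K i j not-KK+1 not-K+1K with i ℕ.≟ j
... | yes refl = trans (≮⇒<ᵇ-false {i} (ℕ.<-irrefl refl)) (sym (≮⇒<ᵇ-false {swapAdj K i} (ℕ.<-irrefl refl)))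
... | no i≢j with i ℕ.≟ K | i ℕ.≟ suc K | j ℕ.≟ K | j ℕ.≟ suc K
... | yes refl | _ | _ | yes refl = ⊥-elim (not-KK+1 (refl , refl))
... | _ | yes refl | yes refl | _ = ⊥-elim (not-K+1K (refl , refl))
... | yes refl | _ | yes refl | _ = ⊥-elim (i≢j refl)
... | _ | yes refl | _ | yes refl = ⊥-elim (i≢j refl)
... | yes refl | _ | no j≢K | no j≢K+1 rewrite swapAdj-at K | swapAdj-other K j j≢K j≢K+1 =
  <ᵇ-cong (λ K<j → ℕ.≤∧≢⇒< K<j (≢-sym j≢K+1)) (ℕ.<-trans (ℕ.n<1+n K))
... | no _ | yes refl | no j≢K | no j≢K+1 rewrite swapAdj-at-suc K | swapAdj-other K j j≢K j≢K+1 =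
  <ᵇ-cong (ℕ.<-trans (ℕ.n<1+n K)) (λ K<j → ℕ.≤∧≢⇒< K<j (≢-sym j≢K+1))
... | no i≢K | no i≢K+1 | yes refl | _ rewrite swapAdj-at K | swapAdj-other K i i≢K i≢K+1 =
  <ᵇ-cong ℕ.m<n⇒m<1+n (λ i<K+1 → ℕ.≤∧≢⇒< (ℕ.s≤s⁻¹ i<K+1) i≢K)
... | no i≢K | no i≢K+1 | no _ | yes refl rewrite swapAdj-at-suc K | swapAdj-other K i i≢K i≢K+1 =
  <ᵇ-cong (λ i<K+1 → ℕ.≤∧≢⇒< (ℕ.s≤s⁻¹ i<K+1) i≢K) ℕ.m<n⇒m<1+n
... | no i≢K | no i≢K+1 | no j≢K | no j≢K+1
  rewrite swapAdj-other K i i≢K i≢K+1 | swapAdj-other K j j≢K j≢K+1 = refl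

swapEnds : ℕ → ℕ → ℕ
swapEnds t i = if i ≡ᵇ 0 then suc t else if i ≡ᵇ suc t then 0 else i

swapEnds-at-suc : ∀ t → swapEnds t (suc t) ≡ 0
swapEnds-at-suc t rewrite ≡ᵇ-refl t = refl

swapEnds-other : ∀ t i → i ≢ 0 → i ≢ suc t → swapEnds t i ≡ i
swapEnds-other t i i≢0 i≢st rewrite ≢⇒≡ᵇ-false i≢0 | ≢⇒≡ᵇ-false i≢st = refl

module RangeSum {A : Set} {_⊕_ : A → A → A} {ε : A}
                (isCommutativeMonoid : IsCommutativeMonoid _≡_ _⊕_ ε) where

  open IsCommutativeMonoid isCommutativeMonoid using (assoc; comm; identityˡ; identityʳ)

  Σ< : ℕ → (ℕ → A) → A
  Σ< zero    g = ε
  Σ< (suc t) g = Σ< t g ⊕ g t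

  single : ℕ → A → ℕ → A
  single p x i = if i ≡ᵇ p then x else ε

  single-at : ∀ p x → single p x p ≡ x
  single-at p x rewrite ≡ᵇ-refl p = refl

  single-other : ∀ p x i → i ≢ p → single p x i ≡ ε
  single-other p x i i≢p rewrite ≢⇒≡ᵇ-false i≢p = refl

  private
    medial : ∀ a b c d → (a ⊕ b) ⊕ (c ⊕ d) ≡ (a ⊕ c) ⊕ (b ⊕ d)
    medial a b c d = begin
      (a ⊕ b) ⊕ (c ⊕ d) ≡⟨ assoc a b (c ⊕ d) ⟩
      a ⊕ (b ⊕ (c ⊕ d)) ≡⟨ cong (a ⊕_) (assoc b c d) ⟨
      a ⊕ ((b ⊕ c) ⊕ d) ≡⟨ cong (λ x → a ⊕ (x ⊕ d)) (comm b c) ⟩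
      a ⊕ ((c ⊕ b) ⊕ d) ≡⟨ cong (a ⊕_) (assoc c b d) ⟩
      a ⊕ (c ⊕ (b ⊕ d)) ≡⟨ assoc a c (b ⊕ d) ⟨
      (a ⊕ c) ⊕ (b ⊕ d) ∎
      where open ≡-Reasoning

    swap-last-two : ∀ a b c → (a ⊕ b) ⊕ c ≡ (a ⊕ c) ⊕ b
    swap-last-two a b c = trans (assoc a b c) (trans (cong (a ⊕_) (comm b c)) (sym (assoc a c b)))

  Σ<-cong : ∀ t {g h} → (∀ i → i ℕ.< t → g i ≡ h i) → Σ< t g ≡ Σ< t h
  Σ<-cong zero    g≡h = refl
  Σ<-cong (suc t) g≡h = cong₂ _⊕_ (Σ<-cong t (λ i i<t → g≡h i (ℕ.m<n⇒m<1+n i<t))) (g≡h t (ℕ.n<1+n t))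

  Σ<-⊕ : ∀ t g h → Σ< t (λ i → g i ⊕ h i) ≡ Σ< t g ⊕ Σ< t h
  Σ<-⊕ zero    g h = sym (identityʳ ε)
  Σ<-⊕ (suc t) g h = trans (cong (_⊕ (g t ⊕ h t)) (Σ<-⊕ t g h)) (medial _ _ _ _)

  Σ<-balance : ∀ t g h a b → (∀ i → i ℕ.< t → g i ⊕ a i ≡ h i ⊕ b i) →
               Σ< t g ⊕ Σ< t a ≡ Σ< t h ⊕ Σ< t b
  Σ<-balance t g h a b eq = trans (sym (Σ<-⊕ t g a)) (trans (Σ<-cong t eq) (Σ<-⊕ t h b))

  Σ<-ε : ∀ t → Σ< t (λ _ → ε) ≡ ε
  Σ<-ε zero    = refl
  Σ<-ε (suc t) = trans (identityʳ _) (Σ<-ε t)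

  Σ<-single : ∀ t p x → p ℕ.< t → Σ< t (single p x) ≡ x
  Σ<-single (suc t) p x p<1+t with ℕ.<-cmp p t
  ... | tri< p<t _ _ = trans (cong₂ _⊕_ (Σ<-single t p x p<t) (single-other p x t (ℕ.>⇒≢ p<t))) (identityʳ x)
  ... | tri≈ _ refl _ =
    trans (cong₂ _⊕_ (trans (Σ<-cong t (λ i i<t → single-other p x i (ℕ.<⇒≢ i<t))) (Σ<-ε t)) (single-at p x))
          (identityˡ x)
  ... | tri> _ _ p>t = ⊥-elim (ℕ.<⇒≱ p>t (ℕ.s≤s⁻¹ p<1+t))

  Σ<-unconsˡ : ∀ t g → Σ< (suc t) g ≡ g 0 ⊕ Σ< t (λ i → g (suc i))
  Σ<-unconsˡ zero    g = trans (identityˡ (g 0)) (sym (identityʳ (g 0)))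
  Σ<-unconsˡ (suc t) g = trans (cong (_⊕ g (suc t)) (Σ<-unconsˡ t g)) (assoc _ _ _)

  Σ<-swapAdj : ∀ K t g → suc K ℕ.< t → Σ< t (λ i → g (swapAdj K i)) ≡ Σ< t g
  Σ<-swapAdj K (suc t) g sK<1+t with ℕ.<-cmp (suc K) t
  ... | tri< sK<t _ _ =
    cong₂ _⊕_ (Σ<-swapAdj K t g sK<t)
              (cong g (swapAdj-other K t (ℕ.>⇒≢ (ℕ.<-trans (ℕ.n<1+n K) sK<t)) (ℕ.>⇒≢ sK<t)))
  ... | tri≈ _ refl _ =
    trans (cong₂ _⊕_ (cong₂ _⊕_ below (cong g (swapAdj-at K))) (cong g (swapAdj-at-suc K)))
          (swap-last-two _ _ _)
    where
    below : Σ< K (λ i → g (swapAdj K i)) ≡ Σ< K g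
    below = Σ<-cong K (λ i i<K → cong g (swapAdj-other K i (ℕ.<⇒≢ i<K) (ℕ.<⇒≢ (ℕ.m<n⇒m<1+n i<K))))
  ... | tri> _ _ sK>t = ⊥-elim (ℕ.<⇒≱ sK>t (ℕ.s≤s⁻¹ sK<1+t))

  Σ<-swapEnds : ∀ t g → Σ< (suc (suc t)) (λ i → g (swapEnds t i)) ≡ Σ< (suc (suc t)) g
  Σ<-swapEnds t g = begin
    Σ< (suc t) g′ ⊕ g′ (suc t)                        ≡⟨ cong₂ _⊕_ (Σ<-unconsˡ t g′) (cong g (swapEnds-at-suc t)) ⟩
    (g (suc t) ⊕ Σ< t (λ i → g′ (suc i))) ⊕ g 0      ≡⟨ cong (λ x → (g (suc t) ⊕ x) ⊕ g 0) (Σ<-cong t middle) ⟩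
    (g (suc t) ⊕ Σ< t (λ i → g (suc i))) ⊕ g 0       ≡⟨ comm _ (g 0) ⟩
    g 0 ⊕ (g (suc t) ⊕ Σ< t (λ i → g (suc i)))       ≡⟨ cong (g 0 ⊕_) (comm _ _) ⟩
    g 0 ⊕ (Σ< t (λ i → g (suc i)) ⊕ g (suc t))       ≡⟨ assoc _ _ _ ⟨
    (g 0 ⊕ Σ< t (λ i → g (suc i))) ⊕ g (suc t)       ≡⟨ cong (_⊕ g (suc t)) (Σ<-unconsˡ t g) ⟨
    Σ< (suc (suc t)) g                                ∎
    where
    open ≡-Reasoning
    g′ : ℕ → A
    g′ i = g (swapEnds t i)
    middle : ∀ i → i ℕ.< t → g′ (suc i) ≡ g (suc i)
    middle i i<t = cong g (swapEnds-other t (suc i) (λ ()) (λ e → ℕ.<⇒≢ i<t (ℕ.suc-injective e)))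

  Σ<-agree-off : ∀ t {g h} p → p ℕ.< t → (∀ i → i ℕ.< t → i ≢ p → g i ≡ h i) →
                 Σ< t g ⊕ h p ≡ Σ< t h ⊕ g p
  Σ<-agree-off t {g} {h} p p<t g≡h = begin
    Σ< t g ⊕ h p                          ≡⟨ cong (Σ< t g ⊕_) (Σ<-single t p (h p) p<t) ⟨
    Σ< t g ⊕ Σ< t (single p (h p))        ≡⟨ Σ<-balance t g h _ _ pointwise ⟩
    Σ< t h ⊕ Σ< t (single p (g p))        ≡⟨ cong (Σ< t h ⊕_) (Σ<-single t p (g p) p<t) ⟩
    Σ< t h ⊕ g p                          ∎
    where
    open ≡-Reasoning
    pointwise : ∀ i → i ℕ.< t → g i ⊕ single p (h p) i ≡ h i ⊕ single p (g p) i
    pointwise i i<t with i ℕ.≟ p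
    ... | yes refl rewrite single-at i (h i) | single-at i (g i) = comm (g i) (h i)
    ... | no i≢p rewrite single-other p (h p) i i≢p | single-other p (g p) i i≢p = cong (_⊕ ε) (g≡h i i<t i≢p)

  Σ<-agree-off₂ : ∀ t {g h} p p′ {x x′ y y′} → p ℕ.< t → p′ ℕ.< t → p ≢ p′ →
                  (∀ i → i ℕ.< t → i ≢ p → i ≢ p′ → g i ≡ h i) →
                  g p ⊕ x ≡ h p ⊕ x′ → g p′ ⊕ y ≡ h p′ ⊕ y′ →
                  Σ< t g ⊕ (x ⊕ y) ≡ Σ< t h ⊕ (x′ ⊕ y′)
  Σ<-agree-off₂ t {g} {h} p p′ {x} {x′} {y} {y′} p<t p′<t p≢p′ g≡h at-p at-p′ = begin
    Σ< t g ⊕ (x ⊕ y)                                        ≡⟨ cong (Σ< t g ⊕_) (Σ<-two x y) ⟨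
    Σ< t g ⊕ Σ< t (λ i → single p x i ⊕ single p′ y i)      ≡⟨ Σ<-balance t g h _ _ pointwise ⟩
    Σ< t h ⊕ Σ< t (λ i → single p x′ i ⊕ single p′ y′ i)    ≡⟨ cong (Σ< t h ⊕_) (Σ<-two x′ y′) ⟩
    Σ< t h ⊕ (x′ ⊕ y′)                                      ∎
    where
    open ≡-Reasoning
    Σ<-two : ∀ a b → Σ< t (λ i → single p a i ⊕ single p′ b i) ≡ a ⊕ b
    Σ<-two a b = trans (Σ<-⊕ t _ _) (cong₂ _⊕_ (Σ<-single t p a p<t) (Σ<-single t p′ b p′<t))
    pointwise : ∀ i → i ℕ.< t → g i ⊕ (single p x i ⊕ single p′ y i) ≡ h i ⊕ (single p x′ i ⊕ single p′ y′ i)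
    pointwise i i<t with i ℕ.≟ p | i ℕ.≟ p′
    ... | yes refl | _ rewrite single-at i x | single-at i x′
                             | single-other p′ y i p≢p′ | single-other p′ y′ i p≢p′
                             | identityʳ x | identityʳ x′ = at-p
    ... | no i≢p | yes refl rewrite single-other p x i i≢p | single-other p x′ i i≢p
                                  | single-at i y | single-at i y′
                                  | identityˡ y | identityˡ y′ = at-p′
    ... | no i≢p | no i≢p′ rewrite single-other p x i i≢p | single-other p x′ i i≢p
                                 | single-other p′ y i i≢p′ | single-other p′ y′ i i≢p′ =
      cong (_⊕ (ε ⊕ ε)) (g≡h i i<t i≢p i≢p′)

  Σ<²-agree-off-pair : ∀ t {M M′ : ℕ → ℕ → A} p p′ → p ℕ.< t → p′ ℕ.< t → p ≢ p′ →
    (∀ i j → i ℕ.< t → j ℕ.< t → ¬ (i ≡ p × j ≡ p′) → ¬ (i ≡ p′ × j ≡ p) → M i j ≡ M′ i j) →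
    Σ< t (λ i → Σ< t (M i)) ⊕ (M′ p p′ ⊕ M′ p′ p) ≡ Σ< t (λ i → Σ< t (M′ i)) ⊕ (M p p′ ⊕ M p′ p)
  Σ<²-agree-off-pair t {M} {M′} p p′ p<t p′<t p≢p′ M≡M′ =
    Σ<-agree-off₂ t p p′ p<t p′<t p≢p′ other-rows
      (Σ<-agree-off t p′ p′<t (λ j j<t j≢p′ → M≡M′ p j p<t j<t (λ (_ , e) → j≢p′ e) (λ (e , _) → p≢p′ e)))
      (Σ<-agree-off t p p<t (λ j j<t j≢p → M≡M′ p′ j p′<t j<t (λ (e , _) → p≢p′ (sym e)) (λ (_ , e) → j≢p e)))
    where
    other-rows : ∀ i → i ℕ.< t → i ≢ p → i ≢ p′ → Σ< t (M i) ≡ Σ< t (M′ i)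
    other-rows i i<t i≢p i≢p′ = Σ<-cong t (λ j j<t → M≡M′ i j i<t j<t (λ (e , _) → i≢p e) (λ (e , _) → i≢p′ e))

module Residues (n : ℕ) .{{_ : ℕ.NonZero n}} where

  N : ℤ
  N = + n

  rem : ℤ → ℕ
  rem x = x ℤ.%ℕ n

  quo : ℤ → ℤ
  quo x = x ℤ./ℕ n

  rem<n : ∀ x → rem x ℕ.< n
  rem<n x = ℤ.n%ℕd<d x n

  decompose : ∀ x → x ≡ + rem x + quo x * N
  decompose x = ℤ.a≡a%ℕn+[a/ℕn]*n x n

  private
    cancel-quotient : ∀ r r′ q d → r + q * N ≡ r′ + (q + d) * N → r ≡ r′ + d * N
    cancel-quotient r r′ q d eq = trans (add-sub r (q * N)) (trans (cong (_- q * N) eq) (rearrange r′ q d N))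
      where
      add-sub : ∀ a b → a ≡ a + b - b
      add-sub = solve-∀
      rearrange : ∀ r′ q d N → r′ + (q + d) * N - q * N ≡ r′ + d * N
      rearrange = solve-∀

    residue-gap : ∀ {r r′} k → r ℕ.< n → + r ≢ + r′ + + suc k * N
    residue-gap {r} {r′} k r<n eq = ℕ.<⇒≱ r<n (begin
      n                      ≤⟨ ℕ.m≤n*m n (suc k) ⟩
      suc k ℕ.* n            ≤⟨ ℕ.m≤n+m _ r′ ⟩
      r′ ℕ.+ suc k ℕ.* n     ≡⟨ ℤ.+-injective (trans eq (cong (λ x → + r′ + x) (sym (ℤ.pos-* (suc k) n)))) ⟨
      r                      ∎)
      where open ℕ.≤-Reasoning

  quotient-unique : ∀ {r r′ q q′} → r ℕ.< n → r′ ℕ.< n → + r + q * N ≡ + r′ + q′ * N → q ≡ q′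
  quotient-unique {r} {r′} {q} {q′} r<n r′<n eq with ℤ.<-cmp q q′
  ... | tri≈ _ q≡q′ _ = q≡q′
  ... | tri< q<q′ _ _ with <⇒≡+suc q<q′
  ...   | k , refl = ⊥-elim (residue-gap k r<n (cancel-quotient (+ r) (+ r′) q (+ suc k) eq))
  quotient-unique {r} {r′} {q} {q′} r<n r′<n eq | tri> _ _ q>q′ with <⇒≡+suc q>q′
  ...   | k , refl = ⊥-elim (residue-gap k r′<n (cancel-quotient (+ r′) (+ r) q′ (+ suc k) (sym eq)))

  residue-unique : ∀ {r r′ q q′} → r ℕ.< n → r′ ℕ.< n → + r + q * N ≡ + r′ + q′ * N → r ≡ r′
  residue-unique {r} {r′} {q} {q′} r<n r′<n eq = ℤ.+-injective (ℤ+-cancelʳ (q * N) (+ r) (+ r′)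
    (trans eq (cong (λ z → + r′ + z * N) (sym (quotient-unique {q = q} {q′} r<n r′<n eq)))))

  rem-unique : ∀ r q → r ℕ.< n → rem (+ r + q * N) ≡ r
  rem-unique r q r<n = residue-unique {q = quo (+ r + q * N)} {q} (rem<n (+ r + q * N)) r<n (sym (decompose (+ r + q * N)))

  quo-unique : ∀ r q → r ℕ.< n → quo (+ r + q * N) ≡ q
  quo-unique r q r<n = quotient-unique {q = quo (+ r + q * N)} {q} (rem<n (+ r + q * N)) r<n (sym (decompose (+ r + q * N)))

Periodic : ℕ → (ℤ → ℤ) → Set
Periodic n f = ∀ x → f (x + + n) ≡ f x + + n

module _ {n : ℕ} {f : ℤ → ℤ} (f-periodic : Periodic n f) where

  periodic-sub : ∀ x → f (x - + n) ≡ f x - + n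
  periodic-sub x = begin
    f (x - + n)            ≡⟨ add-sub (f (x - + n)) (+ n) ⟨
    f (x - + n) + + n - + n ≡⟨ cong (_- + n) (f-periodic (x - + n)) ⟨
    f (x - + n + + n) - + n ≡⟨ cong (λ y → f y - + n) (sub-add x (+ n)) ⟩
    f x - + n              ∎
    where
    open ≡-Reasoning
    add-sub : ∀ y N → y + N - N ≡ y
    add-sub = solve-∀
    sub-add : ∀ x N → x - N + N ≡ x
    sub-add = solve-∀

  private
    periodic-+ℕ* : ∀ x k → f (x + + k * + n) ≡ f x + + k * + n
    periodic-+ℕ* x zero    = trans (cong f (zero-multiple x (+ n))) (sym (zero-multiple (f x) (+ n)))
      where
      zero-multiple : ∀ x N → x + + 0 * N ≡ x
      zero-multiple = solve-∀
    periodic-+ℕ* x (suc k) = begin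
      f (x + + suc k * + n)           ≡⟨ cong f (next-multiple x (+ k) (+ n)) ⟩
      f ((x + + k * + n) + + n)       ≡⟨ f-periodic _ ⟩
      f (x + + k * + n) + + n         ≡⟨ cong (_+ + n) (periodic-+ℕ* x k) ⟩
      (f x + + k * + n) + + n         ≡⟨ next-multiple (f x) (+ k) (+ n) ⟨
      f x + + suc k * + n             ∎
      where
      open ≡-Reasoning
      next-multiple : ∀ x k N → x + (+ 1 + k) * N ≡ (x + k * N) + N
      next-multiple = solve-∀

  periodic-+* : ∀ x q → f (x + q * + n) ≡ f x + q * + n
  periodic-+* x (+ k)    = periodic-+ℕ* x k
  periodic-+* x -[1+ k ] = begin
    f (x + -[1+ k ] * + n)                          ≡⟨ add-sub (f y) K ⟨
    f y + K - K                                     ≡⟨ cong (_- K) (periodic-+ℕ* y (suc k)) ⟨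
    f (y + K) - K                                   ≡⟨ cong (λ z → f z - K) (cancel x (+ suc k) (+ n)) ⟩
    f x - K                                         ≡⟨ neg-multiple (f x) (+ suc k) (+ n) ⟩
    f x + -[1+ k ] * + n                            ∎
    where
    open ≡-Reasoning
    K : ℤ
    K = + suc k * + n
    y : ℤ
    y = x + -[1+ k ] * + n
    add-sub : ∀ a b → a + b - b ≡ a
    add-sub = solve-∀
    cancel : ∀ x k N → x + (- k) * N + k * N ≡ x
    cancel = solve-∀
    neg-multiple : ∀ x k N → x - k * N ≡ x + (- k) * N
    neg-multiple = solve-∀

module Generators (m : ℕ) where

  n : ℕ
  n = suc (suc m)

  open Residues n public

  private
    +1-shifts-residue : ∀ r q → (+ r + q * N) + + 1 ≡ + suc r + q * N
    +1-shifts-residue r q = solve (+ r) q N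
      where
      solve : ∀ r q N → (r + q * N) + + 1 ≡ (+ 1 + r) + q * N
      solve = solve-∀
    -1-shifts-residue : ∀ r q → (+ suc r + q * N) - + 1 ≡ + r + q * N
    -1-shifts-residue r q = solve (+ r) q N
      where
      solve : ∀ r q N → ((+ 1 + r) + q * N) - + 1 ≡ r + q * N
      solve = solve-∀
    N≡1+top : N ≡ + 1 + + suc m
    N≡1+top = ℤ.pos-+ 1 (suc m)
    n%n≡0 : n ℕ.% n ≡ 0
    n%n≡0 = ℕ.n%n≡0 n

  s-inner : ∀ (k : Fin n) → suc (toℕ k) ℕ.< n → ∀ r q → r ℕ.< n →
            s n k (+ r + q * N) ≡ + swapAdj (toℕ k) r + q * N
  s-inner k k+1<n r q r<n rewrite rem-unique r q r<n | ℕ.m<n⇒m%n≡m k+1<n with r ≡ᵇ toℕ k in e₁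
  ... | true = trans (+1-shifts-residue r q) (cong (λ z → + suc z + q * N) (≡ᵇ-true⇒≡ e₁))
  ... | false with r ≡ᵇ suc (toℕ k) in e₂
  ...   | true = trans (cong (λ z → (+ z + q * N) - + 1) (≡ᵇ-true⇒≡ e₂)) (-1-shifts-residue (toℕ k) q)
  ...   | false = refl

  s-last-at-0 : ∀ (k : Fin n) → toℕ k ≡ suc m → ∀ q → s n k (+ 0 + q * N) ≡ + suc m + (q - + 1) * N
  s-last-at-0 k k≡top q rewrite rem-unique 0 q ℕ.z<s | k≡top | n%n≡0 =
    trans (cong (λ z → (+ 0 + q * z) - + 1) N≡1+top)
          (trans (solve q (+ suc m)) (cong (λ z → + suc m + (q - + 1) * z) (sym N≡1+top)))
    where
    solve : ∀ q K → (+ 0 + q * (+ 1 + K)) - + 1 ≡ K + (q - + 1) * (+ 1 + K)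
    solve = solve-∀

  s-last-at-top : ∀ (k : Fin n) → toℕ k ≡ suc m → ∀ q → s n k (+ suc m + q * N) ≡ + 0 + (q + + 1) * N
  s-last-at-top k k≡top q rewrite rem-unique (suc m) q (ℕ.n<1+n (suc m)) | k≡top | ≡ᵇ-refl m =
    trans (cong (λ z → (+ suc m + q * z) + + 1) N≡1+top)
          (trans (solve q (+ suc m)) (cong (λ z → + 0 + (q + + 1) * z) (sym N≡1+top)))
    where
    solve : ∀ q K → (K + q * (+ 1 + K)) + + 1 ≡ + 0 + (q + + 1) * (+ 1 + K)
    solve = solve-∀

  s-last-other : ∀ (k : Fin n) → toℕ k ≡ suc m → ∀ r q → r ℕ.< n → r ≢ 0 → r ≢ suc m →
                 s n k (+ r + q * N) ≡ + r + q * N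
  s-last-other k k≡top r q r<n r≢0 r≢top
    rewrite rem-unique r q r<n | k≡top | n%n≡0 | ≢⇒≡ᵇ-false r≢top | ≢⇒≡ᵇ-false r≢0 = refl

  inner-or-last : ∀ (k : Fin n) → suc (toℕ k) ℕ.< n ⊎ toℕ k ≡ suc m
  inner-or-last k with ℕ.m≤n⇒m<n∨m≡n (ℕ.s≤s⁻¹ (Fin.toℕ<n k))
  ... | inj₁ k<top = inj₁ (ℕ.s≤s k<top)
  ... | inj₂ k≡top = inj₂ k≡top

  private
    next-quotient : ∀ r q → + r + (q + + 1) * N ≡ (+ r + q * N) + N
    next-quotient r q = solve (+ r) q N
      where
      solve : ∀ r q N → r + (q + + 1) * N ≡ (r + q * N) + N
      solve = solve-∀

  s-acts-on-residues : ∀ k r → r ℕ.< n → ∃ λ r′ → ∃ λ c → ∀ q → s n k (+ r + q * N) ≡ + r′ + (q + c) * N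
  s-acts-on-residues k r r<n with inner-or-last k
  ... | inj₁ k+1<n = swapAdj (toℕ k) r , + 0 , λ q →
    trans (s-inner k k+1<n r q r<n) (cong (λ z → + swapAdj (toℕ k) r + z * N) (sym (ℤ.+-identityʳ q)))
  ... | inj₂ k≡top with r ℕ.≟ suc m | r ℕ.≟ 0
  ...   | yes refl | _        = 0 , + 1 , s-last-at-top k k≡top
  ...   | no _     | yes refl = suc m , - + 1 , s-last-at-0 k k≡top
  ...   | no r≢top | no r≢0   = r , + 0 , λ q →
    trans (s-last-other k k≡top r q r<n r≢0 r≢top) (cong (λ z → + r + z * N) (sym (ℤ.+-identityʳ q)))

  s-periodic : ∀ k x → s n k (x + N) ≡ s n k x + N
  s-periodic k x with s-acts-on-residues k (rem x) (rem<n x)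
  ... | r′ , c , act = begin
    s n k (x + N)                          ≡⟨ cong (λ y → s n k (y + N)) (decompose x) ⟩
    s n k ((+ rem x + quo x * N) + N)      ≡⟨ cong (s n k) (next-quotient (rem x) (quo x)) ⟨
    s n k (+ rem x + (quo x + + 1) * N)    ≡⟨ act (quo x + + 1) ⟩
    + r′ + (quo x + + 1 + c) * N           ≡⟨ cong (λ z → + r′ + z * N) (solve (quo x) c) ⟩
    + r′ + ((quo x + c) + + 1) * N         ≡⟨ next-quotient r′ (quo x + c) ⟩
    (+ r′ + (quo x + c) * N) + N           ≡⟨ cong (_+ N) (act (quo x)) ⟨
    s n k (+ rem x + quo x * N) + N        ≡⟨ cong (λ y → s n k y + N) (decompose x) ⟨
    s n k x + N                            ∎
    where
    open ≡-Reasoning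
    solve : ∀ q c → q + + 1 + c ≡ (q + c) + + 1
    solve = solve-∀

  private
    s-involutive-on-window : ∀ k r q → r ℕ.< n → s n k (s n k (+ r + q * N)) ≡ + r + q * N
    s-involutive-on-window k r q r<n with inner-or-last k
    ... | inj₁ k+1<n =
      trans (cong (s n k) (s-inner k k+1<n r q r<n))
            (trans (s-inner k k+1<n _ q (swapAdj-< (toℕ k) k+1<n r<n))
                   (cong (λ z → + z + q * N) (swapAdj-involutive (toℕ k) r)))
    ... | inj₂ k≡top with r ℕ.≟ suc m | r ℕ.≟ 0
    ...   | yes refl | _ =
      trans (cong (s n k) (s-last-at-top k k≡top q))
            (trans (s-last-at-0 k k≡top (q + + 1)) (cong (λ z → + suc m + z * N) (+1-1 q)))
      where
      +1-1 : ∀ q → q + + 1 - + 1 ≡ q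
      +1-1 = solve-∀
    ...   | no _ | yes refl =
      trans (cong (s n k) (s-last-at-0 k k≡top q))
            (trans (s-last-at-top k k≡top (q - + 1)) (cong (λ z → + 0 + z * N) (-1+1 q)))
      where
      -1+1 : ∀ q → q - + 1 + + 1 ≡ q
      -1+1 = solve-∀
    ...   | no r≢top | no r≢0 =
      trans (cong (s n k) (s-last-other k k≡top r q r<n r≢0 r≢top)) (s-last-other k k≡top r q r<n r≢0 r≢top)

  s-involutive : ∀ k x → s n k (s n k x) ≡ x
  s-involutive k x =
    subst (λ y → s n k (s n k y) ≡ y) (sym (decompose x)) (s-involutive-on-window k (rem x) (quo x) (rem<n x))

  private
    +0* : ∀ i → + i ≡ + i + + 0 * N
    +0* i = solve (+ i) N
      where
      solve : ∀ x N → x ≡ x + + 0 * N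
      solve = solve-∀

  s-inner-window : ∀ (k : Fin n) → suc (toℕ k) ℕ.< n → ∀ i → i ℕ.< n → s n k (+ i) ≡ + swapAdj (toℕ k) i
  s-inner-window k k+1<n i i<n =
    trans (cong (s n k) (+0* i)) (trans (s-inner k k+1<n i (+ 0) i<n) (sym (+0* _)))

  s-last-window-0 : ∀ (k : Fin n) → toℕ k ≡ suc m → s n k (+ 0) ≡ + suc m - N
  s-last-window-0 k k≡top = trans (s-last-at-0 k k≡top (+ 0)) (solve (+ suc m) N)
    where
    solve : ∀ a N → a + (+ 0 - + 1) * N ≡ a - N
    solve = solve-∀

  s-last-window-top : ∀ (k : Fin n) → toℕ k ≡ suc m → s n k (+ suc m) ≡ N
  s-last-window-top k k≡top = trans (cong (s n k) (+0* (suc m))) (trans (s-last-at-top k k≡top (+ 0)) (solve N))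
    where
    solve : ∀ N → + 0 + (+ 0 + + 1) * N ≡ N
    solve = solve-∀

  s-last-window-other : ∀ (k : Fin n) → toℕ k ≡ suc m → ∀ i → i ℕ.< n → i ≢ 0 → i ≢ suc m → s n k (+ i) ≡ + i
  s-last-window-other k k≡top i i<n i≢0 i≢top =
    trans (cong (s n k) (+0* i)) (trans (s-last-other k k≡top i (+ 0) i<n i≢0 i≢top) (sym (+0* i)))

  ∘s-periodic : ∀ {f} k → Periodic n f → Periodic n (f ∘ s n k)
  ∘s-periodic {f} k f-periodic x = trans (cong f (s-periodic k x)) (f-periodic _)

module Inversions (m : ℕ) where

  open Generators m
  open RangeSum ℕ.+-0-isCommutativeMonoid

  -- ⌈D/n⌉ for D > 0 and 0 otherwise, i.e. the number of t ≥ 0 with t n < D.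
  ⌈_/n⌉ : ℤ → ℕ
  ⌈ + zero   /n⌉ = 0
  ⌈ + suc d  /n⌉ = suc (d ℕ./ n)
  ⌈ -[1+ d ] /n⌉ = 0

  ⌈/n⌉-nonpos : ∀ D → D ℤ.≤ + 0 → ⌈ D /n⌉ ≡ 0
  ⌈/n⌉-nonpos (+ zero)   _             = refl
  ⌈/n⌉-nonpos -[1+ d ]   _             = refl
  ⌈/n⌉-nonpos (+ suc d)  (ℤ.+≤+ ())

  ⌈/n⌉-pos : ∀ d → ⌈ + suc d /n⌉ ≡ suc ⌈ + suc d - N /n⌉
  ⌈/n⌉-pos d with ℕ.<-≤-connex d n
  ... | inj₁ d<n = cong suc (trans (ℕ.m<n⇒m/n≡0 d<n) (sym (⌈/n⌉-nonpos _ (ℤ.i≤j⇒i-j≤0 (ℤ.+≤+ d<n)))))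
  ... | inj₂ n≤d = cong suc (trans (ℕ.m/n≡1+[m∸n]/n n≤d) (cong ⌈_/n⌉ (sym reduce)))
    where
    reduce : + suc d - N ≡ + suc (d ℕ.∸ n)
    reduce = trans (ℤ.m-n≡m⊖n (suc d) n) (trans (ℤ.⊖-≥ (ℕ.m≤n⇒m≤1+n n≤d)) (cong +_ (ℕ.+-∸-assoc 1 n≤d)))

  inversionsAt : Bool → ℤ → ℕ
  inversionsAt true  D = ⌈ D /n⌉
  inversionsAt false D = ⌈ D - N /n⌉

  -- The number of t such that (i, j + t n) is an inversion of f with i < j + t n.
  inv : (ℤ → ℤ) → ℕ → ℕ → ℕ
  inv f i j = inversionsAt (i <ᵇ j) (f (+ i) - f (+ j))

  inversions : (ℤ → ℤ) → ℕ
  inversions f = Σ< n (λ i → Σ< n (inv f i))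

  inversions-cong : ∀ {f g} → (∀ i → i ℕ.< n → f (+ i) ≡ g (+ i)) → inversions f ≡ inversions g
  inversions-cong f≡g = Σ<-cong n (λ i i<n → Σ<-cong n (λ j j<n →
    cong₂ (λ a b → inversionsAt (i <ᵇ j) (a - b)) (f≡g i i<n) (f≡g j j<n)))

  inversions-id : inversions idℤ ≡ 0
  inversions-id = trans (Σ<-cong n (λ i i<n → trans (Σ<-cong n (λ j _ → no-inversion i j i<n)) (Σ<-ε n))) (Σ<-ε n)
    where
    no-inversion : ∀ i j → i ℕ.< n → inv idℤ i j ≡ 0
    no-inversion i j i<n with i ℕ.<? j
    ... | yes i<j rewrite <⇒<ᵇ-true i<j = ⌈/n⌉-nonpos _ (ℤ.i≤j⇒i-j≤0 (ℤ.+≤+ (ℕ.<⇒≤ i<j)))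
    ... | no  i≮j rewrite ≮⇒<ᵇ-false i≮j =
      ⌈/n⌉-nonpos _ (ℤ.i≤j⇒i-j≤0 (ℤ.≤-trans (ℤ.i-j≤i (+ i) (+ j)) (ℤ.+≤+ (ℕ.<⇒≤ i<n))))

  inversions-exchange : ∀ v f (π : ℕ → ℕ) → (∀ g → Σ< n (λ i → g (π i)) ≡ Σ< n g) →
    ∀ p p′ → p ℕ.< n → p′ ℕ.< n → p ≢ p′ →
    (∀ i j → i ℕ.< n → j ℕ.< n → ¬ (i ≡ p × j ≡ p′) → ¬ (i ≡ p′ × j ≡ p) → inv v i j ≡ inv f (π i) (π j)) →
    inversions v ℕ.+ (inv f (π p) (π p′) ℕ.+ inv f (π p′) (π p)) ≡ inversions f ℕ.+ (inv v p p′ ℕ.+ inv v p′ p)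
  inversions-exchange v f π π-invariant p p′ p<n p′<n p≢p′ agree =
    trans (Σ<²-agree-off-pair n p p′ p<n p′<n p≢p′ agree) (cong (ℕ._+ (inv v p p′ ℕ.+ inv v p′ p)) permuted)
    where
    permuted : Σ< n (λ i → Σ< n (λ j → inv f (π i) (π j))) ≡ inversions f
    permuted = trans (Σ<-cong n (λ i _ → π-invariant (inv f (π i)))) (π-invariant (λ i → Σ< n (inv f i)))

  descentGap : (ℤ → ℤ) → ℕ → ℤ
  descentGap f K = f (+ suc K) - f (+ K)

  Balance : ℕ → ℕ → ℤ → Set
  Balance a b d = a ℕ.+ (⌈ d - N /n⌉ ℕ.+ ⌈ - d /n⌉) ≡ b ℕ.+ (⌈ d /n⌉ ℕ.+ ⌈ - d - N /n⌉)

  -- Right multiplication by s_K only changes the counts of the pairs (K, K + 1) and (K + 1, K).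
  InversionsChange : (ℤ → ℤ) → (ℤ → ℤ) → ℕ → Set
  InversionsChange v f K = Balance (inversions v) (inversions f) (descentGap f K)

  private
    K+1≮K : ∀ K → ¬ (suc K ℕ.< K)
    K+1≮K K K+1<K = ℕ.<-asym K+1<K (ℕ.n<1+n K)

    negate-difference : ∀ a b → b - a ≡ - (a - b)
    negate-difference = solve-∀

    negate-difference-N : ∀ a b M → b - a - M ≡ - (a - b) - M
    negate-difference-N = solve-∀

  inversions-∘s-inner : ∀ (k : Fin n) f → suc (toℕ k) ℕ.< n → InversionsChange (f ∘ s n k) f (toℕ k)
  inversions-∘s-inner k f K+1<n =
    subst₂ (λ x y → inversions v ℕ.+ x ≡ inversions f ℕ.+ y)
           (cong₂ ℕ._+_ swapped-forward swapped-backward) (cong₂ ℕ._+_ forward backward) exchanged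
    where
    K : ℕ
    K = toℕ k
    v : ℤ → ℤ
    v = f ∘ s n k
    K<n : K ℕ.< n
    K<n = ℕ.<-trans (ℕ.n<1+n K) K+1<n
    v-window : ∀ i → i ℕ.< n → v (+ i) ≡ f (+ swapAdj K i)
    v-window i i<n = cong f (s-inner-window k K+1<n i i<n)
    v-at-K : v (+ K) ≡ f (+ suc K)
    v-at-K = trans (v-window K K<n) (cong (λ z → f (+ z)) (swapAdj-at K))
    v-at-K+1 : v (+ suc K) ≡ f (+ K)
    v-at-K+1 = trans (v-window (suc K) K+1<n) (cong (λ z → f (+ z)) (swapAdj-at-suc K))
    exchanged : inversions v ℕ.+ (inv f (swapAdj K K) (swapAdj K (suc K)) ℕ.+ inv f (swapAdj K (suc K)) (swapAdj K K))
                    ≡ inversions f ℕ.+ (inv v K (suc K) ℕ.+ inv v (suc K) K)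
    exchanged = inversions-exchange v f (swapAdj K) (λ g → Σ<-swapAdj K n g K+1<n) K (suc K) K<n K+1<n
      (ℕ.<⇒≢ (ℕ.n<1+n K))
      (λ i j i<n j<n not-KK+1 not-K+1K →
        cong₂ inversionsAt (swapAdj-preserves-< K i j not-KK+1 not-K+1K) (cong₂ _-_ (v-window i i<n) (v-window j j<n)))
    swapped-forward : inv f (swapAdj K K) (swapAdj K (suc K)) ≡ ⌈ descentGap f K - N /n⌉
    swapped-forward rewrite swapAdj-at K | swapAdj-at-suc K | ≮⇒<ᵇ-false (K+1≮K K) = refl
    swapped-backward : inv f (swapAdj K (suc K)) (swapAdj K K) ≡ ⌈ - descentGap f K /n⌉
    swapped-backward rewrite swapAdj-at K | swapAdj-at-suc K | <⇒<ᵇ-true (ℕ.n<1+n K) =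
      cong ⌈_/n⌉ (negate-difference (f (+ suc K)) (f (+ K)))
    forward : inv v K (suc K) ≡ ⌈ descentGap f K /n⌉
    forward rewrite <⇒<ᵇ-true (ℕ.n<1+n K) = cong₂ (λ a b → ⌈ a - b /n⌉) v-at-K v-at-K+1
    backward : inv v (suc K) K ≡ ⌈ - descentGap f K - N /n⌉
    backward rewrite ≮⇒<ᵇ-false (K+1≮K K) =
      trans (cong₂ (λ a b → ⌈ a - b - N /n⌉) v-at-K+1 v-at-K)
            (cong ⌈_/n⌉ (negate-difference-N (f (+ suc K)) (f (+ K)) N))

  inv-diagonal : ∀ g i → inv g i i ≡ ⌈ - N /n⌉
  inv-diagonal g i rewrite ≮⇒<ᵇ-false (ℕ.<-irrefl {i} refl) = cong (λ z → ⌈ z - N /n⌉) (ℤ.+-inverseʳ (g (+ i)))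

  private
    sub-N-swap : ∀ a b N → a - N - b ≡ a - b - N
    sub-N-swap = solve-∀
    sub-sub-N : ∀ a b N → a - (b - N) - N ≡ a - b
    sub-sub-N = solve-∀
    add-N-sub-N : ∀ a b N → a + N - b - N ≡ a - b
    add-N-sub-N = solve-∀
    sub-add-N : ∀ a b N → a - (b + N) ≡ a - b - N
    sub-add-N = solve-∀
    neg-gap : ∀ a b N → - (a + N - b) ≡ b - a - N
    neg-gap = solve-∀
    shifted-gap : ∀ a b N → a + N - (b - N) - N ≡ a + N - b
    shifted-gap = solve-∀
    neg-gap-N : ∀ a b N → - (a + N - b) - N ≡ (b - N) - (a + N)
    neg-gap-N = solve-∀
    inside<top : ∀ {j} → j ℕ.< n → j ≢ suc m → j ℕ.< suc m
    inside<top j<n j≢top = ℕ.≤∧≢⇒< (ℕ.s≤s⁻¹ j<n) j≢top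

  module _ (k : Fin n) (k≡top : toℕ k ≡ suc m) (f : ℤ → ℤ) (f-periodic : Periodic n f) where

    private
      K : ℕ
      K = suc m
      v : ℤ → ℤ
      v = f ∘ s n k
      v-at-0 : v (+ 0) ≡ f (+ K) - N
      v-at-0 = trans (cong f (s-last-window-0 k k≡top)) (periodic-sub {n} {f} f-periodic (+ K))
      v-at-top : v (+ K) ≡ f (+ 0) + N
      v-at-top = trans (cong f (s-last-window-top k k≡top)) (f-periodic (+ 0))
      v-inside : ∀ i → i ℕ.< n → i ≢ 0 → i ≢ K → v (+ i) ≡ f (+ i)
      v-inside i i<n i≢0 i≢K = cong f (s-last-window-other k k≡top i i<n i≢0 i≢K)

    inv-∘s-last-agree : ∀ i j → i ℕ.< n → j ℕ.< n → ¬ (i ≡ K × j ≡ 0) → ¬ (i ≡ 0 × j ≡ K) →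
                        inv v i j ≡ inv f (swapEnds m i) (swapEnds m j)
    inv-∘s-last-agree i j i<n j<n not-top-0 not-0-top with i ℕ.≟ j
    ... | yes refl = trans (inv-diagonal v i) (sym (inv-diagonal f (swapEnds m i)))
    ... | no i≢j with i ℕ.≟ 0 | i ℕ.≟ K | j ℕ.≟ 0 | j ℕ.≟ K
    ... | yes refl | _ | yes refl | _ = ⊥-elim (i≢j refl)
    ... | _ | yes refl | _ | yes refl = ⊥-elim (i≢j refl)
    ... | yes refl | _ | _ | yes refl = ⊥-elim (not-0-top (refl , refl))
    ... | _ | yes refl | yes refl | _ = ⊥-elim (not-top-0 (refl , refl))
    ... | yes refl | _ | no j≢0 | no j≢K
      rewrite swapEnds-other m j j≢0 j≢K | <⇒<ᵇ-true (ℕ.n≢0⇒n>0 j≢0) | ≮⇒<ᵇ-false (ℕ.<⇒≯ (inside<top j<n j≢K)) =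
      trans (cong₂ (λ a b → ⌈ a - b /n⌉) v-at-0 (v-inside j j<n j≢0 j≢K)) (cong ⌈_/n⌉ (sub-N-swap (f (+ K)) (f (+ j)) N))
    ... | no i≢0 | no i≢K | yes refl | _
      rewrite swapEnds-other m i i≢0 i≢K | <⇒<ᵇ-true (inside<top i<n i≢K) =
      trans (cong₂ (λ a b → ⌈ a - b - N /n⌉) (v-inside i i<n i≢0 i≢K) v-at-0) (cong ⌈_/n⌉ (sub-sub-N (f (+ i)) (f (+ K)) N))
    ... | no _ | yes refl | no j≢0 | no j≢K
      rewrite swapEnds-at-suc m | swapEnds-other m j j≢0 j≢K
            | ≮⇒<ᵇ-false (ℕ.<⇒≯ (inside<top j<n j≢K)) | <⇒<ᵇ-true (ℕ.n≢0⇒n>0 j≢0) =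
      trans (cong₂ (λ a b → ⌈ a - b - N /n⌉) v-at-top (v-inside j j<n j≢0 j≢K)) (cong ⌈_/n⌉ (add-N-sub-N (f (+ 0)) (f (+ j)) N))
    ... | no i≢0 | no i≢K | no _ | yes refl
      rewrite swapEnds-at-suc m | swapEnds-other m i i≢0 i≢K | <⇒<ᵇ-true (inside<top i<n i≢K) =
      trans (cong₂ (λ a b → ⌈ a - b /n⌉) (v-inside i i<n i≢0 i≢K) v-at-top) (cong ⌈_/n⌉ (sub-add-N (f (+ i)) (f (+ 0)) N))
    ... | no i≢0 | no i≢K | no j≢0 | no j≢K
      rewrite swapEnds-other m i i≢0 i≢K | swapEnds-other m j j≢0 j≢K =
      cong₂ (λ a b → inversionsAt (i <ᵇ j) (a - b)) (v-inside i i<n i≢0 i≢K) (v-inside j j<n j≢0 j≢K)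

    inversions-∘s-last : InversionsChange (f ∘ s n k) f (suc m)
    inversions-∘s-last =
      subst₂ (λ x y → inversions v ℕ.+ x ≡ inversions f ℕ.+ y)
             (cong₂ ℕ._+_ swapped-forward swapped-backward) (cong₂ ℕ._+_ forward backward) exchanged
      where
      π : ℕ → ℕ
      π = swapEnds m
      exchanged : inversions v ℕ.+ (inv f (π K) (π 0) ℕ.+ inv f (π 0) (π K)) ≡ inversions f ℕ.+ (inv v K 0 ℕ.+ inv v 0 K)
      exchanged = inversions-exchange v f π (Σ<-swapEnds m) K 0 (ℕ.n<1+n K) ℕ.z<s (λ ()) inv-∘s-last-agree
      gap : descentGap f K ≡ f (+ 0) + N - f (+ K)
      gap = cong (_- f (+ K)) (f-periodic (+ 0))
      swapped-forward : inv f (π K) (π 0) ≡ ⌈ descentGap f K - N /n⌉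
      swapped-forward rewrite swapEnds-at-suc m = cong ⌈_/n⌉ (sym (trans (cong (_- N) gap) (add-N-sub-N (f (+ 0)) (f (+ K)) N)))
      swapped-backward : inv f (π 0) (π K) ≡ ⌈ - descentGap f K /n⌉
      swapped-backward rewrite swapEnds-at-suc m = cong ⌈_/n⌉ (sym (trans (cong -_ gap) (neg-gap (f (+ 0)) (f (+ K)) N)))
      forward : inv v K 0 ≡ ⌈ descentGap f K /n⌉
      forward = cong ⌈_/n⌉ (trans (cong₂ (λ a b → a - b - N) v-at-top v-at-0) (trans (shifted-gap (f (+ 0)) (f (+ K)) N) (sym gap)))
      backward : inv v 0 K ≡ ⌈ - descentGap f K - N /n⌉
      backward = cong ⌈_/n⌉ (trans (cong₂ _-_ v-at-0 v-at-top)
                                   (sym (trans (cong (λ z → - z - N) gap) (neg-gap-N (f (+ 0)) (f (+ K)) N))))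

  inversions-∘s : ∀ k f → Periodic n f → InversionsChange (f ∘ s n k) f (toℕ k)
  inversions-∘s k f f-periodic with inner-or-last k
  ... | inj₁ K+1<n = inversions-∘s-inner k f K+1<n
  ... | inj₂ k≡top = subst (InversionsChange (f ∘ s n k) f) (sym k≡top) (inversions-∘s-last k k≡top f f-periodic)

  private
    change-descent : ∀ e a b → Balance a b -[1+ e ] → suc a ≡ b
    change-descent e a b eq = ℕ.+-cancelʳ-≡ (⌈ + suc e - N /n⌉) (suc a) b (begin
      suc a ℕ.+ ⌈ + suc e - N /n⌉    ≡⟨ ℕ.+-suc a _ ⟨
      a ℕ.+ suc ⌈ + suc e - N /n⌉    ≡⟨ cong (a ℕ.+_) (⌈/n⌉-pos e) ⟨
      a ℕ.+ ⌈ + suc e /n⌉            ≡⟨ eq ⟩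
      b ℕ.+ ⌈ + suc e - N /n⌉        ∎)
      where open ≡-Reasoning

    change-bound : ∀ D a b → Balance a b D → a ℕ.≤ suc b
    change-bound (+ zero) a b eq = ℕ.m≤n⇒m≤1+n (ℕ.≤-reflexive (ℕ.+-cancelʳ-≡ 0 a b eq))
    change-bound (+ suc e) a b eq = ℕ.≤-reflexive (ℕ.+-cancelʳ-≡ (⌈ + suc e - N /n⌉ ℕ.+ 0) a (suc b) (begin
      a ℕ.+ (⌈ + suc e - N /n⌉ ℕ.+ 0)       ≡⟨ eq ⟩
      b ℕ.+ (⌈ + suc e /n⌉ ℕ.+ 0)           ≡⟨ cong (λ z → b ℕ.+ (z ℕ.+ 0)) (⌈/n⌉-pos e) ⟩
      b ℕ.+ suc (⌈ + suc e - N /n⌉ ℕ.+ 0)   ≡⟨ ℕ.+-suc b _ ⟩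
      suc b ℕ.+ (⌈ + suc e - N /n⌉ ℕ.+ 0)   ∎))
      where open ≡-Reasoning
    change-bound -[1+ e ] a b eq = ℕ.m≤n⇒m≤1+n (ℕ.<⇒≤ (ℕ.≤-reflexive (change-descent e a b eq)))

  inversions-∘s-≤ : ∀ k f → Periodic n f → inversions (f ∘ s n k) ℕ.≤ suc (inversions f)
  inversions-∘s-≤ k f f-periodic = change-bound (descentGap f (toℕ k)) _ _ (inversions-∘s k f f-periodic)

  inversions-∘s-descent : ∀ k f → Periodic n f → f (+ suc (toℕ k)) ℤ.< f (+ toℕ k) →
                          suc (inversions (f ∘ s n k)) ≡ inversions f
  inversions-∘s-descent k f f-periodic descent with <⇒≡+suc descent
  ... | e , f[K]≡ = change-descent e _ _ (subst (Balance _ _) gap≡ (inversions-∘s k f f-periodic))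
    where
    gap≡ : descentGap f (toℕ k) ≡ -[1+ e ]
    gap≡ = trans (cong (λ x → f (+ suc (toℕ k)) - x) f[K]≡) (solve (f (+ suc (toℕ k))) (+ suc e))
      where
      solve : ∀ a x → a - (a + x) ≡ - x
      solve = solve-∀

module Length (m : ℕ) where

  open Generators m
  open Inversions m
  module ℤΣ = RangeSum ℤ.+-0-isCommutativeMonoid

  inversions-∘evalWord-≤ : ∀ ws g → Periodic n g → inversions (g ∘ evalWord n ws) ℕ.≤ inversions g ℕ.+ length ws
  inversions-∘evalWord-≤ []       g g-periodic = ℕ.m≤m+n (inversions g) 0
  inversions-∘evalWord-≤ (k ∷ ws) g g-periodic = begin
    inversions (g ∘ s n k ∘ evalWord n ws)   ≤⟨ inversions-∘evalWord-≤ ws (g ∘ s n k) (∘s-periodic {g} k g-periodic) ⟩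
    inversions (g ∘ s n k) ℕ.+ length ws     ≤⟨ ℕ.+-monoˡ-≤ (length ws) (inversions-∘s-≤ k g g-periodic) ⟩
    suc (inversions g) ℕ.+ length ws         ≡⟨ ℕ.+-suc (inversions g) (length ws) ⟨
    inversions g ℕ.+ length (k ∷ ws)         ∎
    where open ℕ.≤-Reasoning

  inversions≤length : ∀ {w} ws → evalWord n ws ≈ w → inversions w ℕ.≤ length ws
  inversions≤length {w} ws ws≈w = begin
    inversions w                               ≡⟨ inversions-cong {idℤ ∘ evalWord n ws} {w} (λ i _ → ws≈w (+ i)) ⟨
    inversions (idℤ ∘ evalWord n ws)           ≤⟨ inversions-∘evalWord-≤ ws idℤ (λ _ → refl) ⟩
    inversions idℤ ℕ.+ length ws               ≡⟨ cong (ℕ._+ length ws) inversions-id ⟩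
    length ws                                  ∎
    where open ℕ.≤-Reasoning

  evalWord-snoc : ∀ ws k → evalWord n (ws ++ k ∷ []) ≈ (evalWord n ws ∘ s n k)
  evalWord-snoc []       k x = refl
  evalWord-snoc (j ∷ ws) k x = cong (s n j) (evalWord-snoc ws k x)

  -- The conditions on an affine permutation that are preserved by right multiplication by generators,
  -- with the window {0, …, n - 1} in place of {1, …, n}.
  record IsAffinePerm₀ (f : ℤ → ℤ) : Set where
    field
      periodic  : Periodic n f
      injective : Injective _≡_ _≡_ f
      windowSum : ℤΣ.Σ< n (λ i → f (+ i)) ≡ ℤΣ.Σ< n (λ i → + i)

  windowSum-∘s : ∀ f k → Periodic n f → ℤΣ.Σ< n (λ i → f (s n k (+ i))) ≡ ℤΣ.Σ< n (λ i → f (+ i))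
  windowSum-∘s f k f-periodic with inner-or-last k
  ... | inj₁ K+1<n =
    trans (ℤΣ.Σ<-cong n (λ i i<n → cong f (s-inner-window k K+1<n i i<n))) (ℤΣ.Σ<-swapAdj (toℕ k) n (λ i → f (+ i)) K+1<n)
  ... | inj₂ k≡top =
    trans (ℤ+-cancelʳ (N + + 0) _ _ (trans balanced (cong (λ x → ℤΣ.Σ< n (λ i → f (+ swapEnds m i)) + x) (ℤ.+-comm (+ 0) N))))
          (ℤΣ.Σ<-swapEnds m (λ i → f (+ i)))
    where
    K : ℕ
    K = suc m
    balanced : ℤΣ.Σ< n (λ i → f (s n k (+ i))) + (N + + 0) ≡ ℤΣ.Σ< n (λ i → f (+ swapEnds m i)) + (+ 0 + N)
    balanced = ℤΣ.Σ<-agree-off₂ n 0 K ℕ.z<s (ℕ.n<1+n K) (λ ())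
      (λ i i<n i≢0 i≢K → cong f (trans (s-last-window-other k k≡top i i<n i≢0 i≢K)
                                         (cong +_ (sym (swapEnds-other m i i≢0 i≢K)))))
      (trans (cong (_+ N) (trans (cong f (s-last-window-0 k k≡top)) (periodic-sub {n} {f} f-periodic (+ K)))) (sub-add (f (+ K)) N))
      (trans (cong (_+ + 0) (trans (cong f (s-last-window-top k k≡top)) (f-periodic (+ 0))))
             (trans (ℤ.+-identityʳ _) (cong (_+ N) (sym (cong (λ i → f (+ i)) (swapEnds-at-suc m))))))
      where
      sub-add : ∀ a N → a - N + N ≡ a + + 0
      sub-add = solve-∀

  IsAffinePerm₀-∘s : ∀ {f} k → IsAffinePerm₀ f → IsAffinePerm₀ (f ∘ s n k)
  IsAffinePerm₀-∘s {f} k f-perm = record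
    { periodic  = ∘s-periodic {f} k periodic
    ; injective = λ {x} {y} eq → trans (sym (s-involutive k x)) (trans (cong (s n k) (injective eq)) (s-involutive k y))
    ; windowSum = trans (windowSum-∘s f k periodic) windowSum
    }
    where open IsAffinePerm₀ f-perm

  Ascending : (ℤ → ℤ) → ℕ → Set
  Ascending f t = ∀ K → K ℕ.< t → f (+ K) ℤ.< f (+ suc K)

  private
    +-cancelʳ-≤ : ∀ a b c → a + c ℤ.≤ b + c → a ℤ.≤ b
    +-cancelʳ-≤ a b c a+c≤b+c = subst₂ ℤ._≤_ (add-sub a c) (add-sub b c) (ℤ.+-monoˡ-≤ (- c) a+c≤b+c)
      where
      add-sub : ∀ a c → a + c - c ≡ a
      add-sub = solve-∀

  ascending-gap : ∀ f {t} → Ascending f t → ∀ a d → a ℕ.+ d ℕ.≤ t → f (+ a) + + d ℤ.≤ f (+ (a ℕ.+ d))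
  ascending-gap f asc a zero    _       =
    ℤ.≤-reflexive (trans (ℤ.+-identityʳ _) (cong (λ z → f (+ z)) (sym (ℕ.+-identityʳ a))))
  ascending-gap f {t} asc a (suc d) a+d<t = begin
    f (+ a) + + suc d          ≡⟨ solve (f (+ a)) (+ d) ⟩
    ℤ.suc (f (+ a) + + d)      ≤⟨ ℤ.+-monoʳ-≤ (+ 1) (ascending-gap f asc a d (ℕ.<⇒≤ a+d<t′)) ⟩
    ℤ.suc (f (+ (a ℕ.+ d)))    ≤⟨ ℤ.i<j⇒suc[i]≤j (asc (a ℕ.+ d) a+d<t′) ⟩
    f (+ suc (a ℕ.+ d))        ≡⟨ cong (λ z → f (+ z)) (ℕ.+-suc a d) ⟨
    f (+ (a ℕ.+ suc d))        ∎
    where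
    open ℤ.≤-Reasoning
    a+d<t′ : a ℕ.+ d ℕ.< t
    a+d<t′ = subst (ℕ._≤ t) (ℕ.+-suc a d) a+d<t
    solve : ∀ x d → x + (+ 1 + d) ≡ + 1 + (x + d)
    solve = solve-∀

  ascending-window : ∀ f → Periodic n f → Ascending f n → ∀ t → t ℕ.≤ n → f (+ t) ≡ f (+ 0) + + t
  ascending-window f f-periodic asc t t≤n = ℤ.≤-antisym upper (ascending-gap f asc 0 t t≤n)
    where
    open ℤ.≤-Reasoning
    rest : ℕ
    rest = n ℕ.∸ t
    upper : f (+ t) ℤ.≤ f (+ 0) + + t
    upper = +-cancelʳ-≤ _ _ (+ rest) (begin
      f (+ t) + + rest                ≤⟨ ascending-gap f asc t rest (ℕ.≤-reflexive (ℕ.m+[n∸m]≡n t≤n)) ⟩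
      f (+ (t ℕ.+ rest))              ≡⟨ cong (λ z → f (+ z)) (ℕ.m+[n∸m]≡n t≤n) ⟩
      f (+ 0 + N)                     ≡⟨ f-periodic (+ 0) ⟩
      f (+ 0) + N                     ≡⟨ cong (λ z → f (+ 0) + + z) (ℕ.m+[n∸m]≡n t≤n) ⟨
      f (+ 0) + + (t ℕ.+ rest)        ≡⟨ ℤ.+-assoc (f (+ 0)) (+ t) (+ rest) ⟨
      f (+ 0) + + t + + rest          ∎)

  Σ<-translate : ∀ t c (g : ℕ → ℤ) → ℤΣ.Σ< t (λ i → c + g i) ≡ + t * c + ℤΣ.Σ< t g
  Σ<-translate zero    c g = refl
  Σ<-translate (suc t) c g = begin
    ℤΣ.Σ< t (λ i → c + g i) + (c + g t)         ≡⟨ cong (_+ (c + g t)) (Σ<-translate t c g) ⟩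
    + t * c + ℤΣ.Σ< t g + (c + g t)             ≡⟨ solve (+ t) c (ℤΣ.Σ< t g) (g t) ⟩
    (+ 1 + + t) * c + (ℤΣ.Σ< t g + g t)         ∎
    where
    open ≡-Reasoning
    solve : ∀ t c S x → t * c + S + (c + x) ≡ (+ 1 + t) * c + (S + x)
    solve = solve-∀

  ascending⇒id : ∀ f → IsAffinePerm₀ f → Ascending f n → ∀ x → f x ≡ x
  ascending⇒id f f-perm asc x = begin
    f x                                   ≡⟨ cong f (decompose x) ⟩
    f (+ rem x + quo x * N)               ≡⟨ periodic-+* {n} {f} periodic (+ rem x) (quo x) ⟩
    f (+ rem x) + quo x * N               ≡⟨ cong (_+ quo x * N) (ascending-window f periodic asc (rem x) (ℕ.<⇒≤ (rem<n x))) ⟩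
    f (+ 0) + + rem x + quo x * N         ≡⟨ cong (λ z → z + + rem x + quo x * N) f[0]≡0 ⟩
    + 0 + + rem x + quo x * N             ≡⟨ decompose x ⟨
    x                                     ∎
    where
    open ≡-Reasoning
    open IsAffinePerm₀ f-perm
    S : ℤ
    S = ℤΣ.Σ< n (λ i → + i)
    f[0]≡0 : f (+ 0) ≡ + 0
    f[0]≡0 = ℤ.*-cancelˡ-≡ N (f (+ 0)) (+ 0) (trans (ℤ+-cancelʳ S _ _ (begin
      N * f (+ 0) + S                     ≡⟨ Σ<-translate n (f (+ 0)) (λ i → + i) ⟨
      ℤΣ.Σ< n (λ i → f (+ 0) + + i)       ≡⟨ ℤΣ.Σ<-cong n (λ i i<n → ascending-window f periodic asc i (ℕ.<⇒≤ i<n)) ⟨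
      ℤΣ.Σ< n (λ i → f (+ i))             ≡⟨ windowSum ⟩
      S                                   ≡⟨ ℤ.+-identityˡ S ⟨
      + 0 + S                             ∎)) (sym (ℤ.*-zeroʳ N)))

  non-descent⇒ascent : ∀ {f} → Injective _≡_ _≡_ f → ∀ K → ¬ (f (+ suc K) ℤ.< f (+ K)) → f (+ K) ℤ.< f (+ suc K)
  non-descent⇒ascent f-injective K no-descent =
    ℤ.≤∧≢⇒< (ℤ.≮⇒≥ no-descent) (λ eq → ℕ.1+n≢n (sym (ℤ.+-injective (f-injective eq))))

  descent-or-ascending : ∀ f → Injective _≡_ _≡_ f → ∀ t →
    (∃ λ K → K ℕ.< t × f (+ suc K) ℤ.< f (+ K)) ⊎ Ascending f t
  descent-or-ascending f f-injective zero = inj₂ (λ K ())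
  descent-or-ascending f f-injective (suc t) with descent-or-ascending f f-injective t
  ... | inj₁ (K , K<t , descent) = inj₁ (K , ℕ.m<n⇒m<1+n K<t , descent)
  ... | inj₂ asc with f (+ suc t) ℤ.<? f (+ t)
  ...   | yes descent = inj₁ (t , ℕ.n<1+n t , descent)
  ...   | no  no-descent = inj₂ λ K K<1+t →
    [ asc K , (λ { refl → non-descent⇒ascent f-injective t no-descent }) ]′ (ℕ.m<1+n⇒m<n∨m≡n K<1+t)

  word-of-inversions : ∀ t f → IsAffinePerm₀ f → inversions f ≡ t →
                       ∃ λ ws → length ws ≡ t × evalWord n ws ≈ f
  word-of-inversions t f f-perm inversions≡t with descent-or-ascending f (IsAffinePerm₀.injective f-perm) n
  ... | inj₂ asc = [] , trans (sym no-inversions) inversions≡t , λ x → sym (≈id x)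
    where
    ≈id : ∀ x → f x ≡ x
    ≈id = ascending⇒id f f-perm asc
    no-inversions : inversions f ≡ 0
    no-inversions = trans (inversions-cong {f} {idℤ} (λ i _ → ≈id (+ i))) inversions-id
  ... | inj₁ (K , K<n , descent) = shorter t inversions≡t
    where
    open IsAffinePerm₀ f-perm
    k : Fin n
    k = Fin.fromℕ< K<n
    fewer : suc (inversions (f ∘ s n k)) ≡ inversions f
    fewer = inversions-∘s-descent k f periodic
      (subst (λ z → f (+ suc z) ℤ.< f (+ z)) (sym (Fin.toℕ-fromℕ< K<n)) descent)
    shorter : ∀ t → inversions f ≡ t → ∃ λ ws → length ws ≡ t × evalWord n ws ≈ f
    shorter zero    inversions≡0 = ⊥-elim (ℕ.1+n≢0 (trans fewer inversions≡0))
    shorter (suc t) inversions≡1+t with word-of-inversions t (f ∘ s n k) (IsAffinePerm₀-∘s k f-perm)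
                                          (ℕ.suc-injective (trans fewer inversions≡1+t))
    ... | ws , length≡t , ws≈f∘s = ws ++ k ∷ [] ,
      trans (List.length-++ ws) (trans (ℕ.+-comm (length ws) 1) (cong suc length≡t)) ,
      λ x → trans (evalWord-snoc ws k x) (trans (ws≈f∘s (s n k x)) (cong f (s-involutive k x)))

  isLength-inversions : ∀ {f} → IsAffinePerm₀ f → IsLength n f (inversions f)
  isLength-inversions {f} f-perm = word-of-inversions (inversions f) f f-perm refl , inversions≤length

  private
    sum1to-as-Σ< : ∀ t f → sum1to t f + f (+ 0) ≡ ℤΣ.Σ< (suc t) (λ i → f (+ i))
    sum1to-as-Σ< zero    f = refl
    sum1to-as-Σ< (suc t) f =
      trans (swap-last (sum1to t f) (f (+ suc t)) (f (+ 0))) (cong (_+ f (+ suc t)) (sum1to-as-Σ< t f))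
      where
      swap-last : ∀ a b c → a + b + c ≡ a + c + b
      swap-last = solve-∀

  IsAffinePerm⇒IsAffinePerm₀ : ∀ {w} → IsAffinePerm n w → IsAffinePerm₀ w
  IsAffinePerm⇒IsAffinePerm₀ {w} w-perm = record
    { periodic  = periodic
    ; injective = injective
    ; windowSum = ℤ+-cancelʳ (w (+ 0) + N) _ _ (begin
        ℤΣ.Σ< n (λ i → w (+ i)) + (w (+ 0) + N)   ≡⟨ cong (λ z → ℤΣ.Σ< n (λ i → w (+ i)) + z) (periodic (+ 0)) ⟨
        ℤΣ.Σ< (suc n) (λ i → w (+ i))             ≡⟨ sum1to-as-Σ< n w ⟨
        sum1to n w + w (+ 0)                      ≡⟨ cong (_+ w (+ 0)) sumCond ⟩
        sum1to n idℤ + w (+ 0)                    ≡⟨ cong (_+ w (+ 0)) (sym (ℤ.+-identityʳ (sum1to n idℤ))) ⟩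
        sum1to n idℤ + + 0 + w (+ 0)              ≡⟨ cong (_+ w (+ 0)) (sum1to-as-Σ< n idℤ) ⟩
        ℤΣ.Σ< n (λ i → + i) + N + w (+ 0)         ≡⟨ ℤ.+-assoc (ℤΣ.Σ< n (λ i → + i)) N (w (+ 0)) ⟩
        ℤΣ.Σ< n (λ i → + i) + (N + w (+ 0))       ≡⟨ cong (λ z → ℤΣ.Σ< n (λ i → + i) + z) (ℤ.+-comm N (w (+ 0))) ⟩
        ℤΣ.Σ< n (λ i → + i) + (w (+ 0) + N)       ∎)
    }
    where
    open ≡-Reasoning
    open IsAffinePerm w-perm

  minimal⇒ascent : ∀ {w} → IsAffinePerm n w → MinimalCondition n w →
                   ∀ K → 1 ℕ.≤ K → K ℕ.< n → w (+ K) ℤ.< w (+ suc K)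
  minimal⇒ascent {w} w-perm minimal K 1≤K K<n =
    non-descent⇒ascent (IsAffinePerm.injective w-perm) K λ descent →
      let fewer = inversions-∘s-descent k w (IsAffinePerm.periodic w-perm)
                                        (subst (λ z → w (+ suc z) ℤ.< w (+ z)) (sym k≡K) descent)
          ws , length≡ , ws≈ = word-of-inversions _ (w ∘ s n k) (IsAffinePerm₀-∘s k w₀) refl
      in ℕ.<-irrefl refl (begin-strict
        suc (inversions w)         ≤⟨ proj₂ w∘s-length ws ws≈ ⟩
        length ws                  ≡⟨ length≡ ⟩
        inversions (w ∘ s n k)     <⟨ ℕ.≤-reflexive fewer ⟩
        inversions w               <⟨ ℕ.n<1+n _ ⟩
        suc (inversions w)         ∎)
    where
    open ℕ.≤-Reasoning
    k : Fin n
    k = Fin.fromℕ< K<n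
    k≡K : toℕ k ≡ K
    k≡K = Fin.toℕ-fromℕ< K<n
    w₀ : IsAffinePerm₀ w
    w₀ = IsAffinePerm⇒IsAffinePerm₀ w-perm
    w∘s-length : IsLength n (w ∘ s n k) (suc (inversions w))
    w∘s-length = proj₂ (minimal k (subst (1 ℕ.≤_) (sym k≡K) 1≤K)) (inversions w) (isLength-inversions w₀)

no-injection-into-fewer : ∀ c (g : ℕ → ℕ) → (∀ t → t ℕ.< suc c → g t ℕ.< c) →
                          (∀ t t′ → t ℕ.< suc c → t′ ℕ.< suc c → g t ≡ g t′ → t ≡ t′) → ⊥
no-injection-into-fewer c g g<c g-injective
  with Fin.pigeonhole (ℕ.n<1+n c) (λ (t : Fin (suc c)) → Fin.fromℕ< (g<c (toℕ t) (Fin.toℕ<n t)))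
... | i , j , i<j , same = ℕ.<⇒≢ i<j (g-injective (toℕ i) (toℕ j) (Fin.toℕ<n i) (Fin.toℕ<n j) (begin
  g (toℕ i)                                         ≡⟨ Fin.toℕ-fromℕ< (g<c (toℕ i) (Fin.toℕ<n i)) ⟨
  toℕ (Fin.fromℕ< (g<c (toℕ i) (Fin.toℕ<n i)))     ≡⟨ cong toℕ same ⟩
  toℕ (Fin.fromℕ< (g<c (toℕ j) (Fin.toℕ<n j)))     ≡⟨ Fin.toℕ-fromℕ< (g<c (toℕ j) (Fin.toℕ<n j)) ⟩
  g (toℕ j)                                         ∎))
  where open ≡-Reasoning

module _ (n : ℕ) (g : ℕ → ℕ) (1≤g : ∀ p → 1 ℕ.≤ g p) (g≤n : ∀ p → g p ℕ.≤ n)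
         (g-decreasing : ∀ a b → 1 ℕ.≤ a → a ℕ.< b → b ℕ.≤ n → g b ℕ.< g a) where

  private
    upper : ∀ c → c ℕ.< n → g (suc c) ℕ.≤ n ℕ.∸ c
    upper zero    _       = g≤n 1
    upper (suc c) 1+c<n = begin
      g (suc (suc c))         ≤⟨ ℕ.suc[m]≤n⇒m≤pred[n] (ℕ.<-≤-trans step (upper c (ℕ.<-trans (ℕ.n<1+n c) 1+c<n))) ⟩
      ℕ.pred (n ℕ.∸ c)        ≡⟨ ℕ.pred[m∸n]≡m∸[1+n] n c ⟩
      n ℕ.∸ suc c             ∎
      where
      open ℕ.≤-Reasoning
      step : g (suc (suc c)) ℕ.< g (suc c)
      step = g-decreasing (suc c) (suc (suc c)) ℕ.z<s (ℕ.n<1+n _) 1+c<n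

    lower : ∀ d → d ℕ.< n → suc d ℕ.≤ g (n ℕ.∸ d)
    lower zero    _       = 1≤g n
    lower (suc d) 1+d<n = ℕ.<-≤-trans (ℕ.s≤s (lower d (ℕ.<-trans (ℕ.n<1+n d) 1+d<n))) step
      where
      step : g (n ℕ.∸ d) ℕ.< g (n ℕ.∸ suc d)
      step = g-decreasing (n ℕ.∸ suc d) (n ℕ.∸ d) (ℕ.m<n⇒0<n∸m 1+d<n)
                          (ℕ.∸-monoʳ-< (ℕ.n<1+n d) (ℕ.<⇒≤ 1+d<n)) (ℕ.m∸n≤m n d)

  decreasing⇒reflection : ∀ c → c ℕ.< n → g (suc c) ≡ n ℕ.∸ c
  decreasing⇒reflection c c<n = ℕ.≤-antisym (upper c c<n) (begin
    n ℕ.∸ c                         ≡⟨ ℕ.+-∸-assoc 1 c<n ⟩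
    suc (n ℕ.∸ suc c)               ≤⟨ lower (n ℕ.∸ suc c) (ℕ.∸-monoʳ-< ℕ.z<s c<n) ⟩
    g (n ℕ.∸ (n ℕ.∸ suc c))         ≡⟨ cong g (ℕ.m∸[m∸n]≡n c<n) ⟩
    g (suc c)                       ∎)
    where open ℕ.≤-Reasoning

module TauSymmetry (n : ℕ) .{{_ : ℕ.NonZero n}} where

  open Residues n

  rem₁ : ℤ → ℕ
  rem₁ x = suc (rem (x - + 1))

  quo₁ : ℤ → ℤ
  quo₁ x = quo (x - + 1)

  rem₁≤n : ∀ x → rem₁ x ℕ.≤ n
  rem₁≤n x = rem<n (x - + 1)

  decompose₁ : ∀ x → x ≡ + rem₁ x + quo₁ x * N
  decompose₁ x = trans (solve x) (trans (cong (λ y → + 1 + y) (decompose (x - + 1))) (shift (+ rem (x - + 1)) (quo₁ x) N))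
    where
    solve : ∀ x → x ≡ + 1 + (x - + 1)
    solve = solve-∀
    shift : ∀ r q N → + 1 + (r + q * N) ≡ (+ 1 + r) + q * N
    shift = solve-∀

  private
    predecessor : ∀ r q → + suc r + q * N - + 1 ≡ + r + q * N
    predecessor r q = solve (+ r) q N
      where
      solve : ∀ r q N → (+ 1 + r) + q * N - + 1 ≡ r + q * N
      solve = solve-∀

  rem₁-unique : ∀ r q → 1 ℕ.≤ r → r ℕ.≤ n → rem₁ (+ r + q * N) ≡ r
  rem₁-unique (suc r) q _ r<n = cong suc (trans (cong rem (predecessor r q)) (rem-unique r q r<n))

  quo₁-unique : ∀ r q → 1 ℕ.≤ r → r ℕ.≤ n → quo₁ (+ r + q * N) ≡ q
  quo₁-unique (suc r) q _ r<n = trans (cong quo (predecessor r q)) (quo-unique r q r<n)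

  quotient-dominates : ∀ {ra rb qa qb} → 1 ℕ.≤ ra → rb ℕ.≤ n → qb ℤ.< qa → + rb + qb * N ℤ.< + ra + qa * N
  quotient-dominates {ra} {rb} {qa} {qb} 1≤ra rb≤n qb<qa = begin-strict
    + rb + qb * N         ≤⟨ ℤ.+-monoˡ-≤ (qb * N) (ℤ.+≤+ rb≤n) ⟩
    N + qb * N            ≡⟨ solve qb N ⟩
    (+ 1 + qb) * N        ≤⟨ ℤ.*-monoʳ-≤-nonNeg N (ℤ.i<j⇒suc[i]≤j qb<qa) ⟩
    qa * N                ≡⟨ ℤ.+-identityˡ (qa * N) ⟨
    + 0 + qa * N          <⟨ ℤ.+-monoˡ-< (qa * N) (ℤ.+<+ 1≤ra) ⟩
    + ra + qa * N         ∎
    where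
    open ℤ.≤-Reasoning
    solve : ∀ q N → N + q * N ≡ (+ 1 + q) * N
    solve = solve-∀

  module _ (w : ℤ → ℤ) (w-periodic : Periodic n w) (w-injective : Injective _≡_ _≡_ w)
           (w-involutive : ∀ x → w (w x) ≡ x)
           (w-ascending : ∀ K → 1 ℕ.≤ K → K ℕ.< n → w (+ K) ℤ.< w (+ suc K)) where

    r : ℕ → ℕ
    r p = rem₁ (w (+ p))

    q : ℕ → ℤ
    q p = quo₁ (w (+ p))

    r≤n : ∀ p → r p ℕ.≤ n
    r≤n p = rem₁≤n (w (+ p))

    w-window : ∀ p → w (+ p) ≡ + r p + q p * N
    w-window p = decompose₁ (w (+ p))

    w-at-r : ∀ p → w (+ r p) ≡ + p + (- q p) * N
    w-at-r p = begin
      w (+ r p)                              ≡⟨ add-sub (w (+ r p)) (q p * N) ⟨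
      w (+ r p) + q p * N - q p * N          ≡⟨ cong (_- q p * N) (periodic-+* {n} {w} w-periodic (+ r p) (q p)) ⟨
      w (+ r p + q p * N) - q p * N          ≡⟨ cong (λ x → w x - q p * N) (w-window p) ⟨
      w (w (+ p)) - q p * N                  ≡⟨ cong (_- q p * N) (w-involutive (+ p)) ⟩
      + p - q p * N                          ≡⟨ negate-quotient (+ p) (q p) N ⟩
      + p + (- q p) * N                      ∎
      where
      open ≡-Reasoning
      add-sub : ∀ a b → a + b - b ≡ a
      add-sub = solve-∀
      negate-quotient : ∀ a q N → a - q * N ≡ a + (- q) * N
      negate-quotient = solve-∀

    r-involutive : ∀ p → 1 ℕ.≤ p → p ℕ.≤ n → r (r p) ≡ p
    r-involutive p 1≤p p≤n = trans (cong rem₁ (w-at-r p)) (rem₁-unique p (- q p) 1≤p p≤n)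

    q-∘r : ∀ p → 1 ℕ.≤ p → p ℕ.≤ n → q (r p) ≡ - q p
    q-∘r p 1≤p p≤n = trans (cong quo₁ (w-at-r p)) (quo₁-unique p (- q p) 1≤p p≤n)

    w-increasing : ∀ a b → 1 ℕ.≤ a → a ℕ.< b → b ℕ.≤ n → w (+ a) ℤ.< w (+ b)
    w-increasing a (suc b) 1≤a a<1+b 1+b≤n with ℕ.m<1+n⇒m<n∨m≡n a<1+b
    ... | inj₂ refl = w-ascending a 1≤a 1+b≤n
    ... | inj₁ a<b  = ℤ.<-trans (w-increasing a b 1≤a a<b (ℕ.<⇒≤ 1+b≤n))
                                (w-ascending b (ℕ.≤-trans 1≤a (ℕ.<⇒≤ a<b)) 1+b≤n)

    w-reflects-< : ∀ a b → 1 ℕ.≤ a → a ℕ.≤ n → 1 ℕ.≤ b → b ℕ.≤ n → w (+ a) ℤ.< w (+ b) → a ℕ.< b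
    w-reflects-< a b 1≤a a≤n 1≤b b≤n wa<wb with ℕ.<-cmp a b
    ... | tri< a<b _ _  = a<b
    ... | tri≈ _ refl _ = ⊥-elim (ℤ.<-irrefl refl wa<wb)
    ... | tri> _ _ b<a  = ⊥-elim (ℤ.<-asym wa<wb (w-increasing b a 1≤b b<a a≤n))

    q-monotone : ∀ a b → 1 ℕ.≤ a → a ℕ.≤ b → b ℕ.≤ n → q a ℤ.≤ q b
    q-monotone a b 1≤a a≤b b≤n = ℤ.≮⇒≥ λ qb<qa → ℤ.<-irrefl refl (wb<wb qb<qa)
      where
      wb<wb : q b ℤ.< q a → w (+ b) ℤ.< w (+ b)
      wb<wb qb<qa with ℕ.m≤n⇒m<n∨m≡n a≤b
      ... | inj₂ refl = ⊥-elim (ℤ.<-irrefl refl qb<qa)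
      ... | inj₁ a<b  = ℤ.<-trans
        (subst₂ ℤ._<_ (sym (w-window b)) (sym (w-window a)) (quotient-dominates ℕ.z<s (r≤n b) qb<qa))
        (w-increasing a b 1≤a a<b b≤n)

    q-reflects-< : ∀ a b → 1 ℕ.≤ a → a ℕ.≤ n → 1 ℕ.≤ b → b ℕ.≤ n → q a ℤ.< q b → a ℕ.< b
    q-reflects-< a b 1≤a a≤n 1≤b b≤n qa<qb with ℕ.<-cmp a b
    ... | tri< a<b _ _  = a<b
    ... | tri≈ _ refl _ = ⊥-elim (ℤ.<-irrefl refl qa<qb)
    ... | tri> _ _ b<a  = ⊥-elim (ℤ.<⇒≱ qa<qb (q-monotone b a 1≤b (ℕ.<⇒≤ b<a) a≤n))

    r-injective : ∀ {a b} → 1 ℕ.≤ a → a ℕ.≤ n → 1 ℕ.≤ b → b ℕ.≤ n → r a ≡ r b → a ≡ b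
    r-injective {a} {b} 1≤a a≤n 1≤b b≤n ra≡rb =
      trans (sym (r-involutive a 1≤a a≤n)) (trans (cong r ra≡rb) (r-involutive b 1≤b b≤n))

    private
      module Antisymmetry (c : ℕ) (c<n : c ℕ.< n) where
        M : ℕ
        M = n ℕ.∸ c
        1≤M : 1 ℕ.≤ M
        1≤M = ℕ.m<n⇒0<n∸m c<n
        M≤n : M ℕ.≤ n
        M≤n = ℕ.m∸n≤m n c
        M+c≡n : M ℕ.+ c ≡ n
        M+c≡n = ℕ.m∸n+n≡m (ℕ.<⇒≤ c<n)

        -- Otherwise r maps the c + 1 positions 1, …, c + 1 into the c positions M + 1, …, n.
        not-below : ¬ (q M ℤ.< - q (suc c))
        not-below qM<-qc+1 = no-injection-into-fewer c g g<c g-injective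
          where
          g : ℕ → ℕ
          g t = r (suc t) ℕ.∸ suc M
          M<r : ∀ t → t ℕ.< suc c → M ℕ.< r (suc t)
          M<r t t<1+c = q-reflects-< M (r (suc t)) 1≤M M≤n ℕ.z<s (r≤n (suc t)) (ℤ.<-≤-trans qM<-qc+1 (begin
            - q (suc c)        ≤⟨ ℤ.neg-mono-≤ (q-monotone (suc t) (suc c) ℕ.z<s t<1+c c<n) ⟩
            - q (suc t)        ≡⟨ q-∘r (suc t) ℕ.z<s (ℕ.≤-trans t<1+c c<n) ⟨
            q (r (suc t))      ∎))
            where open ℤ.≤-Reasoning
          g<c : ∀ t → t ℕ.< suc c → g t ℕ.< c
          g<c t t<1+c = subst (g t ℕ.<_) (ℕ.m∸[m∸n]≡n (ℕ.<⇒≤ c<n)) (ℕ.∸-monoˡ-< (ℕ.s≤s (r≤n (suc t))) (M<r t t<1+c))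
          g-injective : ∀ t t′ → t ℕ.< suc c → t′ ℕ.< suc c → g t ≡ g t′ → t ≡ t′
          g-injective t t′ t<1+c t′<1+c gt≡gt′ =
            ℕ.suc-injective (r-injective ℕ.z<s (ℕ.≤-trans t<1+c c<n) ℕ.z<s (ℕ.≤-trans t′<1+c c<n)
                                         (ℕ.∸-cancelʳ-≡ (M<r t t<1+c) (M<r t′ t′<1+c) gt≡gt′))

        -- Otherwise r maps the c + 1 positions M, …, n into the c positions 1, …, c.
        not-above : ¬ (- q (suc c) ℤ.< q M)
        not-above -qc+1<qM = no-injection-into-fewer c g g<c g-injective
          where
          g : ℕ → ℕ
          g t = ℕ.pred (r (M ℕ.+ t))
          M+t≤n : ∀ t → t ℕ.< suc c → M ℕ.+ t ℕ.≤ n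
          M+t≤n t t<1+c = subst (M ℕ.+ t ℕ.≤_) M+c≡n (ℕ.+-monoʳ-≤ M (ℕ.s≤s⁻¹ t<1+c))
          1≤M+t : ∀ t → 1 ℕ.≤ M ℕ.+ t
          1≤M+t t = ℕ.≤-trans 1≤M (ℕ.m≤m+n M t)
          g<c : ∀ t → t ℕ.< suc c → g t ℕ.< c
          g<c t t<1+c = ℕ.s≤s⁻¹ (q-reflects-< (r (M ℕ.+ t)) (suc c) ℕ.z<s (r≤n (M ℕ.+ t)) ℕ.z<s c<n (begin-strict
            q (r (M ℕ.+ t))    ≡⟨ q-∘r (M ℕ.+ t) (1≤M+t t) (M+t≤n t t<1+c) ⟩
            - q (M ℕ.+ t)      ≤⟨ ℤ.neg-mono-≤ (q-monotone M (M ℕ.+ t) 1≤M (ℕ.m≤m+n M t) (M+t≤n t t<1+c)) ⟩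
            - q M              <⟨ ℤ.neg-mono-< -qc+1<qM ⟩
            - - q (suc c)      ≡⟨ ℤ.neg-involutive (q (suc c)) ⟩
            q (suc c)          ∎))
            where open ℤ.≤-Reasoning
          g-injective : ∀ t t′ → t ℕ.< suc c → t′ ℕ.< suc c → g t ≡ g t′ → t ≡ t′
          g-injective t t′ t<1+c t′<1+c gt≡gt′ = ℕ.+-cancelˡ-≡ M t t′
            (r-injective (1≤M+t t) (M+t≤n t t<1+c) (1≤M+t t′) (M+t≤n t′ t′<1+c) (cong suc gt≡gt′))

    q-antisymmetric : ∀ c → c ℕ.< n → q (n ℕ.∸ c) ≡ - q (suc c)
    q-antisymmetric c c<n with ℤ.<-cmp (q (n ℕ.∸ c)) (- q (suc c))
    ... | tri< below _ _ = ⊥-elim (Antisymmetry.not-below c c<n below)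
    ... | tri≈ _ equal _ = equal
    ... | tri> _ _ above = ⊥-elim (Antisymmetry.not-above c c<n above)

    private
      1+n-1+c : ∀ c → c ℕ.≤ n → + suc n - + suc c ≡ + (n ℕ.∸ c)
      1+n-1+c c c≤n = trans (ℤ.m-n≡m⊖n (suc n) (suc c)) (ℤ.⊖-≥ (ℕ.s≤s c≤n))

      reflect-window : ∀ c Q → c ℕ.≤ n → + suc n - (+ suc c + Q * N) ≡ + (n ℕ.∸ c) + (- Q) * N
      reflect-window c Q c≤n = trans (solve (+ suc n) (+ suc c) Q N) (cong (λ z → z + (- Q) * N) (1+n-1+c c c≤n))
        where
        solve : ∀ S C Q N → S - (C + Q * N) ≡ (S - C) + (- Q) * N
        solve = solve-∀

    mirror : ℕ → ℕ
    mirror p = r (n ℕ.∸ ℕ.pred (r p))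

    w-mirror : ∀ p → 1 ℕ.≤ p → p ℕ.≤ n → w (+ mirror p) ≡ + suc n - w (+ p)
    w-mirror p 1≤p p≤n = begin
      w (+ r M)                          ≡⟨ w-at-r M ⟩
      + M + (- q M) * N                  ≡⟨ cong (λ z → + M + z * N) -qM≡-qp ⟩
      + M + (- q p) * N                  ≡⟨ reflect-window c (q p) (ℕ.<⇒≤ (r≤n p)) ⟨
      + suc n - (+ r p + q p * N)        ≡⟨ cong (λ y → + suc n - y) (w-window p) ⟨
      + suc n - w (+ p)                  ∎
      where
      open ≡-Reasoning
      c : ℕ
      c = ℕ.pred (r p)
      M : ℕ
      M = n ℕ.∸ c
      -qM≡-qp : - q M ≡ - q p
      -qM≡-qp = trans (cong -_ (q-antisymmetric c (r≤n p))) (trans (ℤ.neg-involutive (q (r p))) (q-∘r p 1≤p p≤n))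

    mirror-decreasing : ∀ a b → 1 ℕ.≤ a → a ℕ.< b → b ℕ.≤ n → mirror b ℕ.< mirror a
    mirror-decreasing a b 1≤a a<b b≤n = w-reflects-< (mirror b) (mirror a) ℕ.z<s (r≤n _) ℕ.z<s (r≤n _)
      (subst₂ ℤ._<_ (sym (w-mirror b 1≤b b≤n)) (sym (w-mirror a 1≤a a≤n))
        (ℤ.+-monoʳ-< (+ suc n) (ℤ.neg-mono-< (w-increasing a b 1≤a a<b b≤n))))
      where
      1≤b : 1 ℕ.≤ b
      1≤b = ℕ.≤-trans 1≤a (ℕ.<⇒≤ a<b)
      a≤n : a ℕ.≤ n
      a≤n = ℕ.≤-trans (ℕ.<⇒≤ a<b) b≤n

    w-commutes-with-τ : ∀ x → w (+ suc n - x) ≡ + suc n - w x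
    w-commutes-with-τ x = begin
      w (+ suc n - x)                            ≡⟨ cong (λ y → w (+ suc n - y)) (decompose₁ x) ⟩
      w (+ suc n - (+ suc c + Q * N))            ≡⟨ cong w (reflect-window c Q (ℕ.<⇒≤ c<n)) ⟩
      w (+ (n ℕ.∸ c) + (- Q) * N)                ≡⟨ periodic-+* {n} {w} w-periodic (+ (n ℕ.∸ c)) (- Q) ⟩
      w (+ (n ℕ.∸ c)) + (- Q) * N                ≡⟨ cong (λ p → w (+ p) + (- Q) * N) mirror≡ ⟨
      w (+ mirror (suc c)) + (- Q) * N           ≡⟨ cong (_+ (- Q) * N) (w-mirror (suc c) ℕ.z<s c<n) ⟩
      + suc n - w (+ suc c) + (- Q) * N          ≡⟨ solve (+ suc n) (w (+ suc c)) Q N ⟩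
      + suc n - (w (+ suc c) + Q * N)            ≡⟨ cong (λ y → + suc n - y) (periodic-+* {n} {w} w-periodic (+ suc c) Q) ⟨
      + suc n - w (+ suc c + Q * N)              ≡⟨ cong (λ y → + suc n - w y) (decompose₁ x) ⟨
      + suc n - w x                              ∎
      where
      open ≡-Reasoning
      c : ℕ
      c = rem (x - + 1)
      Q : ℤ
      Q = quo₁ x
      c<n : c ℕ.< n
      c<n = rem<n (x - + 1)
      mirror≡ : mirror (suc c) ≡ n ℕ.∸ c
      mirror≡ = decreasing⇒reflection n mirror (λ _ → ℕ.z<s) (λ _ → r≤n _) mirror-decreasing c c<n
      solve : ∀ S A Q N → S - A + (- Q) * N ≡ S - (A + Q * N)
      solve = solve-∀

    τ∘w-involutive : ∀ x → + suc n - w (+ suc n - w x) ≡ x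
    τ∘w-involutive x = begin
      + suc n - w (+ suc n - w x)     ≡⟨ cong (λ y → + suc n - y) (w-commutes-with-τ (w x)) ⟩
      + suc n - (+ suc n - w (w x))   ≡⟨ solve (+ suc n) (w (w x)) ⟩
      w (w x)                         ≡⟨ w-involutive x ⟩
      x                               ∎
      where
      open ≡-Reasoning
      solve : ∀ S a → S - (S - a) ≡ a
      solve = solve-∀

corollary2p14 : ∀ (n : ℕ) → 2 ℕ.≤ n → ∀ (w : ℤ → ℤ) → Ω n w → Ω′ n w
corollary2p14 (suc zero) (ℕ.s≤s ()) w
corollary2p14 (suc (suc m)) _ w (w-perm , w-involutive , w-minimal) =
  w-perm ,
  TauSymmetry.τ∘w-involutive (suc (suc m)) w periodic injective w-involutive
    (Length.minimal⇒ascent m w-perm w-minimal) ,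
  w-minimal
  where open IsAffinePerm w-perm
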